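{- For every integer $r\ge3$, \[ \mathscr{P}_{C_r} (q) = (1+q)^2\bigl( \mathscr{P}_{C_{r-1}} (q)-q\bigr) - q^3 \left( \sum_{i=1}^{r-2} \mathscr{P}_{C_i}(q) \right )+(q+q^2+q^3), \] where $\mathscr{P}_{C_i}(q)$ denotes the $q$-analog of Kostant's partition function at the highest root of type $C_i$.
   Context: Type $C_r$, $r\ge1$: with simple roots $\alpha_1,\dots,\alpha_r$ ($\alpha_r$ long), the positive roots are $\alpha_i+\cdots+\alpha_j$ for $1\le i\le j\le r$; $\alpha_i+\cdots+\alpha_{j-1}+2\alpha_j+\cdots+2\alpha_{r-1}+\alpha_r$ for $1\le i<j\le r-1$; and $2\alpha_i+\cdots+2\alpha_{r-1}+\alpha_r$ for $1\le i\le r-1$. The highest root is $\tilde\alpha=2\alpha_1+\cdots+2\alpha_{r-1}+\alpha_r$ (for $r=1$, $\tilde\alpha=\alpha_1$). A partition of $\tilde\alpha$ with $k$ parts is a multiset of $k$ positive roots (repetitions allowed) summing to $\tilde\alpha$, and $\mathscr{P}_{C_r}(q)=\sum_{k\ge1}a_kq^k$ where $a_k$ is the number of partitions of $\tilde\alpha$ with exactly $k$ parts. -}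

module Defs where

open import Data.Nat as ℕ using (ℕ; zero; suc; _∸_; _≤ᵇ_; _≡ᵇ_)
open import Data.Bool using (Bool; true; false; if_then_else_; _∧_)
open import Data.List using (List; []; _∷_; _++_; map; concat; concatMap; length; filter; foldr; zipWith; replicate; upTo)
open import Data.List.Properties using (≡-dec)
open import Data.Integer as ℤ using (ℤ; +_)
open import Relation.Binary.PropositionalEquality using (_≡_)
open import Relation.Nullary.Decidable using (Dec)

-- Elements of the root lattice of C_r are represented by their coefficient
-- lists w.r.t. the simple roots α₁,…,α_r (a list of length r).

range1 : ℕ → List ℕ
range1 r = map suc (upTo r)

mkRoot : ℕ → (ℕ → ℕ) → List ℕ
mkRoot r f = map f (range1 r)

between : ℕ → ℕ → ℕ → Bool
between i j p = (i ≤ᵇ p) ∧ (p ≤ᵇ j)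

-- α_i + ⋯ + α_j   (1 ≤ i ≤ j ≤ r)
rootA : ℕ → ℕ → ℕ → List ℕ
rootA r i j = mkRoot r (λ p → if between i j p then 1 else 0)

-- α_i + ⋯ + α_{j-1} + 2α_j + ⋯ + 2α_{r-1} + α_r   (1 ≤ i < j ≤ r-1)
rootB : ℕ → ℕ → ℕ → List ℕ
rootB r i j = mkRoot r (λ p →
  if p ≡ᵇ r then 1 else
  if between j (r ∸ 1) p then 2 else
  if between i (j ∸ 1) p then 1 else 0)

-- 2α_i + ⋯ + 2α_{r-1} + α_r   (1 ≤ i ≤ r-1)
rootC : ℕ → ℕ → List ℕ
rootC r i = mkRoot r (λ p →
  if p ≡ᵇ r then 1 else
  if between i (r ∸ 1) p then 2 else 0)

positiveRoots : ℕ → List (List ℕ)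
positiveRoots r =
  concatMap (λ i → map (rootA r i) (filter (λ j → i ℕ.≤? j) (range1 r))) (range1 r)
  ++ concatMap (λ i → map (rootB r i) (filter (λ j → i ℕ.<? j) (range1 (r ∸ 1)))) (range1 (r ∸ 1))
  ++ map (rootC r) (range1 (r ∸ 1))

-- highest root  2α₁ + ⋯ + 2α_{r-1} + α_r   (= α₁ for r = 1)
highestRoot : ℕ → List ℕ
highestRoot r = mkRoot r (λ p → if p ≡ᵇ r then 1 else 2)

-- all multisets of size k of elements of a list (as weakly ordered sublists with repetition)
multisets : {A : Set} → List A → ℕ → List (List A)
multisets [] zero = [] ∷ []
multisets [] (suc k) = []
multisets (x ∷ xs) zero = [] ∷ []
multisets (x ∷ xs) (suc k) = map (x ∷_) (multisets (x ∷ xs) k) ++ multisets xs (suc k)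

vsum : ℕ → List (List ℕ) → List ℕ
vsum r = foldr (zipWith ℕ._+_) (replicate r 0)

partitions : ℕ → ℕ → List (List (List ℕ))
partitions r k = filter (λ m → ≡-dec ℕ._≟_ (vsum r m) (highestRoot r)) (multisets (positiveRoots r) k)

numPartitions : ℕ → ℕ → ℕ
numPartitions r k = length (partitions r k)

-- Polynomials in q with integer coefficients, as coefficient sequences
-- (equality of polynomials = equality of all coefficients).

Poly : Set
Poly = ℕ → ℤ

infixl 6 _⊕_ _⊖_
infixl 7 _⊗_

_⊕_ : Poly → Poly → Poly
(f ⊕ g) n = f n ℤ.+ g n

_⊖_ : Poly → Poly → Poly
(f ⊖ g) n = f n ℤ.- g n

_⊗_ : Poly → Poly → Poly
(f ⊗ g) n = foldr ℤ._+_ (+ 0) (map (λ i → f i ℤ.* g (n ∸ i)) (upTo (suc n)))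

qpow : ℕ → Poly
qpow d n = if n ≡ᵇ d then + 1 else + 0

onePlusQ : Poly
onePlusQ = qpow 0 ⊕ qpow 1

𝒫C : ℕ → Poly
𝒫C r zero = + 0
𝒫C r (suc k) = + numPartitions r (suc k)

sum𝒫C : ℕ → Poly
sum𝒫C zero = λ _ → + 0
sum𝒫C (suc m) = sum𝒫C m ⊕ 𝒫C (suc m)

module Submission where

-- Every positive root of C_r has α_r-coefficient 0 or 1 and the
-- highest root has α_r-coefficient 1, so a partition of the highest root
-- contains exactly one root x with α_r-coefficient 1; all other parts are
-- "interval roots" α_i + ⋯ + α_j of the type A_{r-1} subsystem.  For each
-- such x the remainder is a "shape" (2,…,2,1,…,1,0,…,0) with a twos and b
-- ones, so  a_{k+1}(C_r) = Σ_{1 ≤ i ≤ j ≤ r} F(i-1, j-i, k)  where F(a, b, k)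
-- counts k-multisets of interval roots summing to that shape.  Looking at
-- the last non-zero coordinate of a shape gives a recursion for F, which is
-- then taken as a definition, independent of the rank.  From it we derive,
-- by bookkeeping on coefficient sequences, the identity
--   P_r + q³ Σ_{i ≤ r-2} P_i + q² = (1+q)² P_{r-1}   (coefficients in ℕ),
-- and the stated identity over ℤ follows by a ring computation.

open import Defs
open import Data.Nat using (ℕ; _≤_; _∸_)
open import Relation.Binary.PropositionalEquality using (_≡_)

open import Data.Nat as ℕ using (zero; suc; _+_; _<_; z≤n; s≤s; _≤ᵇ_; _≡ᵇ_; _≤?_)
open import Data.Nat.Properties
open import Data.Nat.Tactic.RingSolver using (solve-∀)
open import Data.Integer as ℤ using (ℤ)
import Data.Integer.Properties as ℤP
import Data.Integer.Tactic.RingSolver as ℤSolver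
open import Data.Bool using (Bool; true; false; if_then_else_; _∧_) renaming (T to IsTrue)
open import Data.Bool.Properties using (∧-assoc; ∧-identityʳ; ∧-zeroʳ; if-swap-then)
open import Data.List using (List; []; _∷_; _++_; map; concatMap; length; filter; foldr; zipWith; replicate; upTo; applyUpTo)
open import Data.List.Properties as ListP using (≡-dec)
open import Data.List.Relation.Unary.All as All using (All; []; _∷_)
import Data.List.Relation.Unary.All.Properties as AllP
open import Data.Product using (Σ; _×_; _,_)
open import Data.Sum using (_⊎_; inj₁; inj₂)
open import Data.Empty using (⊥-elim)
open import Relation.Binary.PropositionalEquality using (refl; sym; trans; cong; cong₂; subst; _≢_; module ≡-Reasoning)
open import Relation.Nullary using (does; yes; no)
open import Relation.Unary using (Decidable)

≤ᵇ-true : ∀ {m n} → m ≤ n → (m ≤ᵇ n) ≡ true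
≤ᵇ-true {m} {n} p with m ≤ᵇ n | ≤⇒≤ᵇ p
... | true | _ = refl

≤ᵇ-false : ∀ {m n} → n < m → (m ≤ᵇ n) ≡ false
≤ᵇ-false {m} {n} p with m ≤ᵇ n | ≤ᵇ⇒≤ m n
... | false | _ = refl
... | true | sound = ⊥-elim (<⇒≱ p (sound _))

≤ᵇ-sound : ∀ {m n} → (m ≤ᵇ n) ≡ true → m ≤ n
≤ᵇ-sound {m} {n} e = ≤ᵇ⇒≤ m n (subst IsTrue (sym e) _)

≡ᵇ-true : ∀ {m n} → m ≡ n → (m ≡ᵇ n) ≡ true
≡ᵇ-true {m} {n} p with m ≡ᵇ n | ≡⇒≡ᵇ m n p
... | true | _ = refl

≡ᵇ-false : ∀ {m n} → m ≢ n → (m ≡ᵇ n) ≡ false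
≡ᵇ-false {m} {n} p with m ≡ᵇ n | ≡ᵇ⇒≡ m n
... | false | _ = refl
... | true | sound = ⊥-elim (p (sound _))

≡ᵇ-sound : ∀ {m n} → (m ≡ᵇ n) ≡ true → m ≡ n
≡ᵇ-sound {m} {n} e = ≡ᵇ⇒≡ m n (subst IsTrue (sym e) _)

≡ᵇ-false-sound : ∀ {m n} → (m ≡ᵇ n) ≡ false → m ≢ n
≡ᵇ-false-sound {m} {n} e p = subst IsTrue e (≡⇒≡ᵇ m n p)

≡ᵇ-comm : ∀ m n → (m ≡ᵇ n) ≡ (n ≡ᵇ m)
≡ᵇ-comm zero zero = refl
≡ᵇ-comm zero (suc n) = refl
≡ᵇ-comm (suc m) zero = refl
≡ᵇ-comm (suc m) (suc n) = ≡ᵇ-comm m n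

if-true : ∀ {A : Set} {b} {x y : A} → b ≡ true → (if b then x else y) ≡ x
if-true refl = refl

if-false : ∀ {A : Set} {b} {x y : A} → b ≡ false → (if b then x else y) ≡ y
if-false refl = refl

if-0 : ∀ b → (if b then 0 else 0) ≡ 0
if-0 true = refl
if-0 false = refl

if-cong-then : ∀ b {x y : ℕ} → (b ≡ true → x ≡ y) → (if b then x else 0) ≡ (if b then y else 0)
if-cong-then true h = h refl
if-cong-then false h = refl

if-∧ : ∀ a b (x : ℕ) → (if a then (if b then x else 0) else 0) ≡ (if a ∧ b then x else 0)
if-∧ true b x = refl
if-∧ false b x = refl

if-+ : ∀ b (x y : ℕ) → (if b then x + y else 0) ≡ (if b then x else 0) + (if b then y else 0)
if-+ true x y = refl
if-+ false x y = refl

if-split : ∀ b (x : ℕ) → x ≡ (if b then x else 0) + (if b then 0 else x)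
if-split true x = sym (+-identityʳ x)
if-split false x = refl

∧-true : ∀ {a b} → a ≡ true → b ≡ true → (a ∧ b) ≡ true
∧-true refl refl = refl

∧-interchange : ∀ a b c d → ((a ∧ b) ∧ (c ∧ d)) ≡ ((a ∧ c) ∧ (b ∧ d))
∧-interchange true true c d = refl
∧-interchange true false c d = sym (∧-zeroʳ c)
∧-interchange false b c d = refl

≤ᵇ-+ : ∀ a b c → ((a ≤ᵇ c) ∧ (b ≤ᵇ c ∸ a)) ≡ (a + b ≤ᵇ c)
≤ᵇ-+ a b c with a ≤? c
... | no a≰c = trans (cong (_∧ (b ≤ᵇ c ∸ a)) (≤ᵇ-false (≰⇒> a≰c))) (sym (≤ᵇ-false (<-≤-trans (≰⇒> a≰c) (m≤m+n a b))))
... | yes a≤c with b ≤? c ∸ a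
...   | yes b≤ = trans (cong₂ _∧_ (≤ᵇ-true a≤c) (≤ᵇ-true b≤))
                   (sym (≤ᵇ-true (subst (a + b ≤_) (m+[n∸m]≡n a≤c) (+-monoʳ-≤ a b≤))))
...   | no b≰ = trans (cong₂ _∧_ (≤ᵇ-true a≤c) (≤ᵇ-false (≰⇒> b≰)))
                   (sym (≤ᵇ-false (subst (_< a + b) (m+[n∸m]≡n a≤c) (+-monoʳ-< a (≰⇒> b≰)))))

≡ᵇ-+ : ∀ a b c → (a + b ≡ᵇ c) ≡ ((a ≤ᵇ c) ∧ (b ≡ᵇ c ∸ a))
≡ᵇ-+ a b c with a ≤? c
... | no a≰c = trans (≡ᵇ-false (λ h → a≰c (subst (a ≤_) h (m≤m+n a b)))) (sym (cong (_∧ (b ≡ᵇ c ∸ a)) (≤ᵇ-false (≰⇒> a≰c))))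
... | yes a≤c with b ℕ.≟ c ∸ a
...   | yes b≡ = trans (≡ᵇ-true (trans (cong (a +_) b≡) (m+[n∸m]≡n a≤c))) (sym (cong₂ _∧_ (≤ᵇ-true a≤c) (≡ᵇ-true b≡)))
...   | no b≢ = trans (≡ᵇ-false (λ h → b≢ (trans (sym (m+n∸m≡n a b)) (cong (_∸ a) h))))
                  (sym (cong₂ _∧_ (≤ᵇ-true a≤c) (≡ᵇ-false b≢)))

≤1-cases : ∀ {n} → n ≤ 1 → (n ≡ 0) ⊎ (n ≡ 1)
≤1-cases z≤n = inj₁ refl
≤1-cases (s≤s z≤n) = inj₂ refl

halve : ∀ x y → x + x ≡ y + y → x ≡ y
halve x y e = *-cancelˡ-≡ x y 2 (trans (cong (x +_) (+-identityʳ x)) (trans e (sym (cong (y +_) (+-identityʳ y)))))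

allUpTo : ℕ → (ℕ → Bool) → Bool
allUpTo zero f = true
allUpTo (suc n) f = allUpTo n f ∧ f (suc n)

∧-true-split : ∀ {a b} → (a ∧ b) ≡ true → (a ≡ true) × (b ≡ true)
∧-true-split {true} e = refl , e

allUpTo-elim : ∀ n f → allUpTo n f ≡ true → ∀ p → 1 ≤ p → p ≤ n → f p ≡ true
allUpTo-elim zero f e p h1 h2 = ⊥-elim (<⇒≱ h1 h2)
allUpTo-elim (suc n) f e p h1 h2 with ∧-true-split {allUpTo n f} e | m≤n⇒m<n∨m≡n h2
... | eₙ , _ | inj₁ (s≤s p≤n) = allUpTo-elim n f eₙ p h1 p≤n
... | _ , eₚ | inj₂ refl = eₚ

allUpTo-intro : ∀ n f → (∀ p → 1 ≤ p → p ≤ n → f p ≡ true) → allUpTo n f ≡ true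
allUpTo-intro zero f h = refl
allUpTo-intro (suc n) f h = ∧-true (allUpTo-intro n f (λ p a b → h p a (m≤n⇒m≤1+n b))) (h (suc n) (s≤s z≤n) ≤-refl)

allUpTo-false : ∀ n f p → 1 ≤ p → p ≤ n → f p ≡ false → allUpTo n f ≡ false
allUpTo-false n f p h1 h2 e with allUpTo n f in eq
... | false = refl
... | true = sym (trans (sym e) (allUpTo-elim n f eq p h1 h2))

allUpTo-cong : ∀ n {f g} → (∀ p → 1 ≤ p → p ≤ n → f p ≡ g p) → allUpTo n f ≡ allUpTo n g
allUpTo-cong zero h = refl
allUpTo-cong (suc n) h = cong₂ _∧_ (allUpTo-cong n (λ p a b → h p a (m≤n⇒m≤1+n b))) (h (suc n) (s≤s z≤n) ≤-refl)

allUpTo-∧ : ∀ n f g → allUpTo n (λ p → f p ∧ g p) ≡ (allUpTo n f ∧ allUpTo n g)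
allUpTo-∧ zero f g = refl
allUpTo-∧ (suc n) f g = trans (cong (_∧ (f (suc n) ∧ g (suc n))) (allUpTo-∧ n f g)) (∧-interchange (allUpTo n f) (allUpTo n g) _ _)

allUpTo-cons : ∀ n f → allUpTo (suc n) f ≡ (f 1 ∧ allUpTo n (λ p → f (suc p)))
allUpTo-cons zero f = sym (∧-identityʳ (f 1))
allUpTo-cons (suc n) f = trans (cong (_∧ f (suc (suc n))) (allUpTo-cons n f)) (∧-assoc (f 1) _ _)

+-interchange : ∀ a b c d → a + b + (c + d) ≡ a + c + (b + d)
+-interchange = solve-∀

sumTo : ℕ → (ℕ → ℕ) → ℕ
sumTo zero f = 0
sumTo (suc n) f = sumTo n f + f (suc n)

sumTo-cong : ∀ n {f g} → (∀ i → 1 ≤ i → i ≤ n → f i ≡ g i) → sumTo n f ≡ sumTo n g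
sumTo-cong zero h = refl
sumTo-cong (suc n) h = cong₂ _+_ (sumTo-cong n (λ p a b → h p a (m≤n⇒m≤1+n b))) (h (suc n) (s≤s z≤n) ≤-refl)

sumTo-+ : ∀ n f g → sumTo n (λ i → f i + g i) ≡ sumTo n f + sumTo n g
sumTo-+ zero f g = refl
sumTo-+ (suc n) f g = trans (cong (_+ (f (suc n) + g (suc n))) (sumTo-+ n f g)) (+-interchange (sumTo n f) (sumTo n g) _ _)

sumTo-zero : ∀ n f → (∀ i → 1 ≤ i → i ≤ n → f i ≡ 0) → sumTo n f ≡ 0
sumTo-zero zero f h = refl
sumTo-zero (suc n) f h = trans (cong₂ _+_ (sumTo-zero n f (λ i a b → h i a (m≤n⇒m≤1+n b))) (h (suc n) (s≤s z≤n) ≤-refl)) refl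

sumTo-single : ∀ n s f → 1 ≤ s → s ≤ n → (∀ i → 1 ≤ i → i ≤ n → i ≢ s → f i ≡ 0) → sumTo n f ≡ f s
sumTo-single zero s f h1 h2 h = ⊥-elim (<⇒≱ h1 h2)
sumTo-single (suc n) s f h1 h2 h with s ℕ.≟ suc n
... | yes refl = cong (_+ f (suc n)) (sumTo-zero n f (λ i a b → h i a (m≤n⇒m≤1+n b) (λ e → <⇒≢ (s≤s b) e)))
... | no s≢ = trans (cong (sumTo n f +_) (h (suc n) (s≤s z≤n) ≤-refl (λ e → s≢ (sym e))))
                (trans (+-identityʳ _) (sumTo-single n s f h1 (≤-pred (≤∧≢⇒< h2 s≢)) (λ i a b → h i a (m≤n⇒m≤1+n b))))

sumTo-trunc : ∀ m n f → m ≤ n → (∀ i → m < i → i ≤ n → f i ≡ 0) → sumTo n f ≡ sumTo m f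
sumTo-trunc m zero f z≤n h = refl
sumTo-trunc m (suc n) f le h with m≤n⇒m<n∨m≡n le
... | inj₁ (s≤s m≤n) = trans (cong (sumTo n f +_) (h (suc n) (s≤s m≤n) ≤-refl))
                         (trans (+-identityʳ _) (sumTo-trunc m n f m≤n (λ i a b → h i a (m≤n⇒m≤1+n b))))
... | inj₂ refl = refl

sumTo-swap : ∀ n m (g : ℕ → ℕ → ℕ) → sumTo n (λ i → sumTo m (g i)) ≡ sumTo m (λ j → sumTo n (λ i → g i j))
sumTo-swap zero m g = sym (sumTo-zero m _ (λ _ _ _ → refl))
sumTo-swap (suc n) m g = begin
    sumTo n (λ i → sumTo m (g i)) + sumTo m (g (suc n))      ≡⟨ cong (_+ sumTo m (g (suc n))) (sumTo-swap n m g) ⟩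
    sumTo m (λ j → sumTo n (λ i → g i j)) + sumTo m (g (suc n)) ≡⟨ sym (sumTo-+ m _ _) ⟩
    sumTo m (λ j → sumTo n (λ i → g i j) + g (suc n) j)      ∎
  where open ≡-Reasoning

sumTo-split : ∀ a b f → sumTo (a + b) f ≡ sumTo a f + sumTo b (λ i → f (a + i))
sumTo-split a zero f = trans (cong (λ z → sumTo z f) (+-identityʳ a)) (sym (+-identityʳ _))
sumTo-split a (suc b) f = begin
    sumTo (a + suc b) f                                         ≡⟨ cong (λ z → sumTo z f) (+-suc a b) ⟩
    sumTo (a + b) f + f (suc (a + b))                           ≡⟨ cong (_+ f (suc (a + b))) (sumTo-split a b f) ⟩
    sumTo a f + sumTo b (λ i → f (a + i)) + f (suc (a + b))     ≡⟨ +-assoc (sumTo a f) _ _ ⟩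
    sumTo a f + (sumTo b (λ i → f (a + i)) + f (suc (a + b)))   ≡⟨ cong (λ z → sumTo a f + (sumTo b (λ i → f (a + i)) + f z)) (sym (+-suc a b)) ⟩
    sumTo a f + (sumTo b (λ i → f (a + i)) + f (a + suc b))     ∎
  where open ≡-Reasoning

sumTo-triangle : ∀ n (G : ℕ → ℕ → ℕ) →
  sumTo n (λ i → sumTo n (λ j → if suc i ≤ᵇ j then G j i else 0)) + sumTo n (λ i → G i i) ≡ sumTo n (λ j → sumTo j (G j))
sumTo-triangle n G = begin
    sumTo n (λ i → sumTo n (λ j → if suc i ≤ᵇ j then G j i else 0)) + diag
      ≡⟨ cong (_+ diag) (sumTo-swap n n (λ i j → if suc i ≤ᵇ j then G j i else 0)) ⟩
    sumTo n (λ j → sumTo n (λ i → if suc i ≤ᵇ j then G j i else 0)) + diag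
      ≡⟨ cong (_+ diag) (sumTo-cong n below) ⟩
    sumTo n (λ j → sumTo (j ∸ 1) (G j)) + diag
      ≡⟨ sym (sumTo-+ n _ _) ⟩
    sumTo n (λ j → sumTo (j ∸ 1) (G j) + G j j)
      ≡⟨ sumTo-cong n (λ { (suc j) _ _ → refl }) ⟩
    sumTo n (λ j → sumTo j (G j)) ∎
  where
  open ≡-Reasoning
  diag = sumTo n (λ i → G i i)
  below : ∀ j → 1 ≤ j → j ≤ n → sumTo n (λ i → if suc i ≤ᵇ j then G j i else 0) ≡ sumTo (j ∸ 1) (G j)
  below (suc j) _ j<n = trans (sumTo-trunc j n _ (≤-trans (n≤1+n j) j<n) (λ i j<i _ → if-false (≤ᵇ-false (s≤s j<i))))
                               (sumTo-cong j (λ i _ i≤j → if-true (≤ᵇ-true (s≤s i≤j))))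

sumTo-symmetric-square : ∀ a (W : ℕ → ℕ → ℕ) → (∀ i i' → W i i' ≡ W i' i) →
  sumTo a (λ i → sumTo a (W i)) + sumTo a (λ i → W i i) ≡ sumTo a (λ i' → sumTo i' (λ i → W i i')) + sumTo a (λ i' → sumTo i' (λ i → W i i'))
sumTo-symmetric-square a W sym-W = begin
    sumTo a (λ i → sumTo a (W i)) + diag
      ≡⟨ cong (_+ diag) (trans (sumTo-cong a (λ i _ _ → trans (sumTo-cong a (λ i' _ _ → if-split (suc i ≤ᵇ i') (W i i'))) (sumTo-+ a _ _))) (sumTo-+ a _ _)) ⟩
    (upper + lower) + diag ≡⟨ rearrange upper lower diag ⟩
    (upper + diag) + lower ≡⟨ cong₂ _+_ (sumTo-triangle a (λ j i → W i j)) lower≡ ⟩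
    triangle + triangle ∎
  where
  open ≡-Reasoning
  diag = sumTo a (λ i → W i i)
  upper = sumTo a (λ i → sumTo a (λ i' → if suc i ≤ᵇ i' then W i i' else 0))
  lower = sumTo a (λ i → sumTo a (λ i' → if suc i ≤ᵇ i' then 0 else W i i'))
  triangle = sumTo a (λ i' → sumTo i' (λ i → W i i'))
  rearrange : ∀ x y z → (x + y) + z ≡ (x + z) + y
  rearrange = solve-∀
  lower≡ : lower ≡ triangle
  lower≡ = sumTo-cong a (λ i _ i≤a → trans (sumTo-trunc i a _ i≤a (λ i' i<i' _ → if-true (≤ᵇ-true i<i')))
             (sumTo-cong i (λ i' _ i'≤i → trans (if-false (≤ᵇ-false (s≤s i'≤i))) (sym-W i i'))))

sumOver : ∀ {A : Set} → List A → (A → ℕ) → ℕ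
sumOver [] f = 0
sumOver (x ∷ xs) f = f x + sumOver xs f

sumOver-cong : ∀ {A : Set} (xs : List A) {f g} → (∀ a → f a ≡ g a) → sumOver xs f ≡ sumOver xs g
sumOver-cong [] h = refl
sumOver-cong (x ∷ xs) h = cong₂ _+_ (h x) (sumOver-cong xs h)

sumOver-++ : ∀ {A : Set} (xs ys : List A) f → sumOver (xs ++ ys) f ≡ sumOver xs f + sumOver ys f
sumOver-++ [] ys f = refl
sumOver-++ (x ∷ xs) ys f = trans (cong (f x +_) (sumOver-++ xs ys f)) (sym (+-assoc (f x) _ _))

sumOver-map : ∀ {A B : Set} (g : A → B) xs f → sumOver (map g xs) f ≡ sumOver xs (λ a → f (g a))
sumOver-map g [] f = refl
sumOver-map g (x ∷ xs) f = cong (f (g x) +_) (sumOver-map g xs f)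

sumOver-concatMap : ∀ {A B : Set} (g : A → List B) xs f → sumOver (concatMap g xs) f ≡ sumOver xs (λ a → sumOver (g a) f)
sumOver-concatMap g [] f = refl
sumOver-concatMap g (x ∷ xs) f = trans (sumOver-++ (g x) (concatMap g xs) f) (cong (sumOver (g x) f +_) (sumOver-concatMap g xs f))

sumOver-+ : ∀ {A : Set} (xs : List A) f g → sumOver xs (λ a → f a + g a) ≡ sumOver xs f + sumOver xs g
sumOver-+ [] f g = refl
sumOver-+ (x ∷ xs) f g = trans (cong (f x + g x +_) (sumOver-+ xs f g)) (+-interchange (f x) (g x) _ _)

sumOver-if : ∀ {A : Set} (xs : List A) b f → (if b then sumOver xs f else 0) ≡ sumOver xs (λ a → if b then f a else 0)
sumOver-if xs true f = refl
sumOver-if [] false f = refl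
sumOver-if (x ∷ xs) false f = sumOver-if xs false f

sumOver-filter : ∀ {A : Set} {P : A → Set} (P? : Decidable P) xs f → sumOver (filter P? xs) f ≡ sumOver xs (λ a → if does (P? a) then f a else 0)
sumOver-filter P? [] f = refl
sumOver-filter P? (x ∷ xs) f with does (P? x)
... | true = cong (f x +_) (sumOver-filter P? xs f)
... | false = sumOver-filter P? xs f

bfilter : ∀ {A : Set} → (A → Bool) → List A → List A
bfilter p [] = []
bfilter p (x ∷ xs) = if p x then x ∷ bfilter p xs else bfilter p xs

sumOver-bfilter : ∀ {A : Set} (p : A → Bool) xs f → sumOver (bfilter p xs) f ≡ sumOver xs (λ a → if p a then f a else 0)
sumOver-bfilter p [] f = refl
sumOver-bfilter p (x ∷ xs) f with p x
... | true = cong (f x +_) (sumOver-bfilter p xs f)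
... | false = sumOver-bfilter p xs f

sumOver-range1 : ∀ n f → sumOver (range1 n) f ≡ sumTo n f
sumOver-range1 n f = trans (sumOver-map suc (upTo n) f) (go n)
  where
  snoc : ∀ (h : ℕ → ℕ) n g → sumOver (applyUpTo h (suc n)) g ≡ sumOver (applyUpTo h n) g + g (h n)
  snoc h zero g = +-identityʳ _
  snoc h (suc n) g = trans (cong (g (h 0) +_) (snoc (λ i → h (suc i)) n g)) (sym (+-assoc (g (h 0)) _ _))
  go : ∀ n → sumOver (upTo n) (λ a → f (suc a)) ≡ sumTo n f
  go zero = refl
  go (suc n) = trans (snoc (λ i → i) n (λ a → f (suc a))) (cong (_+ f (suc n)) (go n))

bfilter-keep : ∀ {A : Set} (p : A → Bool) x xs → p x ≡ true → bfilter p (x ∷ xs) ≡ x ∷ bfilter p xs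
bfilter-keep p x xs e rewrite e = refl

bfilter-drop : ∀ {A : Set} (p : A → Bool) x xs → p x ≡ false → bfilter p (x ∷ xs) ≡ bfilter p xs
bfilter-drop p x xs e rewrite e = refl

-- pairSum M φ = Σ φ x y over pairs x, y of M with x at or before y in M,
-- i.e. over the 2-multisets {x, y} of M.
pairSum : ∀ {A : Set} → List A → (A → A → ℕ) → ℕ
pairSum [] φ = 0
pairSum (x ∷ M) φ = sumOver (x ∷ M) (φ x) + pairSum M φ

pairSum-+ : ∀ {A : Set} (M : List A) f g → pairSum M (λ x y → f x y + g x y) ≡ pairSum M f + pairSum M g
pairSum-+ [] f g = refl
pairSum-+ (x ∷ M) f g = trans (cong₂ _+_ (sumOver-+ (x ∷ M) (f x) (g x)) (pairSum-+ M f g))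
                              (+-interchange (f x x + sumOver M (f x)) (g x x + sumOver M (g x)) (pairSum M f) (pairSum M g))

pairSum-cong : ∀ {A : Set} (M : List A) {f g} → (∀ x y → f x y ≡ g x y) → pairSum M f ≡ pairSum M g
pairSum-cong [] h = refl
pairSum-cong (x ∷ M) h = cong₂ _+_ (sumOver-cong (x ∷ M) (h x)) (pairSum-cong M h)

pairSum-if : ∀ {A : Set} (M : List A) b f → (if b then pairSum M f else 0) ≡ pairSum M (λ x y → if b then f x y else 0)
pairSum-if M true f = refl
pairSum-if M false f = sym (pairSum-0 M)
  where
  sumOver-0 : ∀ M → sumOver M (λ _ → 0) ≡ 0
  sumOver-0 [] = refl
  sumOver-0 (x ∷ M) = sumOver-0 M
  pairSum-0 : ∀ M → pairSum M (λ _ _ → 0) ≡ 0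
  pairSum-0 [] = refl
  pairSum-0 (x ∷ M) = cong₂ _+_ (sumOver-0 M) (pairSum-0 M)

pairSum-double : ∀ {A : Set} (f : A → A → ℕ) → (∀ x y → f x y ≡ f y x) → ∀ M →
  pairSum M f + pairSum M f ≡ sumOver M (λ x → sumOver M (f x)) + sumOver M (λ x → f x x)
pairSum-double f sym-f [] = refl
pairSum-double f sym-f (x ∷ M) = begin
    (f x x + S + P) + (f x x + S + P)        ≡⟨ regroup (f x x) S P ⟩
    f x x + S + S + f x x + (P + P)          ≡⟨ cong (λ z → f x x + S + S + f x x + z) (pairSum-double f sym-f M) ⟩
    f x x + S + S + f x x + (SS + D)         ≡⟨ cong (λ z → f x x + S + z + f x x + (SS + D)) (sumOver-cong M (sym-f x)) ⟩
    f x x + S + S' + f x x + (SS + D)        ≡⟨ regroup′ (f x x) S S' SS D ⟩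
    (f x x + S) + (S' + SS) + (f x x + D)    ≡⟨ cong (λ z → (f x x + S) + z + (f x x + D)) (sym (sumOver-+ M (λ y → f y x) (λ y → sumOver M (f y)))) ⟩
    (f x x + S) + sumOver M (λ y → f y x + sumOver M (f y)) + (f x x + D) ∎
  where
  open ≡-Reasoning
  S = sumOver M (f x)
  S' = sumOver M (λ y → f y x)
  P = pairSum M f
  SS = sumOver M (λ y → sumOver M (f y))
  D = sumOver M (λ y → f y y)
  regroup : ∀ a s p → (a + s + p) + (a + s + p) ≡ a + s + s + a + (p + p)
  regroup = solve-∀
  regroup′ : ∀ a s s' ss d → a + s + s' + a + (ss + d) ≡ (a + s) + (s' + ss) + (a + d)
  regroup′ = solve-∀

-- Counting multisets of vectors with a prescribed sum
--
-- Elements of the root lattice of rank r are coefficient functions on the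
-- positions 1, …, r (values at other positions are irrelevant).

Vector : Set
Vector = ℕ → ℕ

module Multisets (r : ℕ) where

  infix 4 _≈_
  infixl 6 _∸V_ _+V_
  infix 7 _≤V_

  _≈_ : Vector → Vector → Set
  t ≈ u = ∀ p → 1 ≤ p → p ≤ r → t p ≡ u p

  ≈-refl : ∀ {t} → t ≈ t
  ≈-refl p a b = refl

  Respects≈ : (Vector → ℕ) → Set
  Respects≈ g = ∀ {x x'} → x ≈ x' → g x ≡ g x'

  _≤V_ : Vector → Vector → Bool
  x ≤V t = allUpTo r (λ p → x p ≤ᵇ t p)

  isZero : Vector → Bool
  isZero t = allUpTo r (λ p → t p ≡ᵇ 0)

  _∸V_ : Vector → Vector → Vector
  (t ∸V x) p = t p ∸ x p

  _+V_ : Vector → Vector → Vector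
  (t +V x) p = t p + x p

  ≤V-intro : ∀ x t → (∀ p → 1 ≤ p → p ≤ r → x p ≤ t p) → x ≤V t ≡ true
  ≤V-intro x t h = allUpTo-intro r _ (λ p a b → ≤ᵇ-true (h p a b))

  ≤V-refute : ∀ x t p → 1 ≤ p → p ≤ r → t p < x p → x ≤V t ≡ false
  ≤V-refute x t p a b h = allUpTo-false r _ p a b (≤ᵇ-false h)

  zeroIndicator : Vector → ℕ
  zeroIndicator t = if isZero t then 1 else 0

  -- count L t k = number of k-element multisets of elements of L with sum t:
  -- either the head x of L occurs (and may occur again), or it does not.
  count : List Vector → Vector → ℕ → ℕ
  count L t zero = zeroIndicator t
  count [] t (suc k) = 0
  count (x ∷ L) t (suc k) = (if x ≤V t then count (x ∷ L) (t ∸V x) k else 0) + count L t (suc k)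

  ≤V-cong : ∀ {x x' t t'} → x ≈ x' → t ≈ t' → x ≤V t ≡ x' ≤V t'
  ≤V-cong hx ht = allUpTo-cong r (λ p a b → cong₂ _≤ᵇ_ (hx p a b) (ht p a b))

  isZero-cong : ∀ {t t'} → t ≈ t' → isZero t ≡ isZero t'
  isZero-cong ht = allUpTo-cong r (λ p a b → cong (_≡ᵇ 0) (ht p a b))

  ∸V-cong : ∀ {t t' x x'} → t ≈ t' → x ≈ x' → (t ∸V x) ≈ (t' ∸V x')
  ∸V-cong ht hx p a b = cong₂ _∸_ (ht p a b) (hx p a b)

  count-cong : ∀ L k {t t'} → t ≈ t' → count L t k ≡ count L t' k
  count-cong L zero ht = cong (λ b → if b then 1 else 0) (isZero-cong ht)
  count-cong [] (suc k) ht = refl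
  count-cong (x ∷ L) (suc k) {t} {t'} ht =
    cong₂ _+_ (cong₂ (λ b n → if b then n else 0) (≤V-cong {x} {x} {t} {t'} ≈-refl ht)
                                                (count-cong (x ∷ L) k (∸V-cong {t} {t'} {x} {x} ht ≈-refl)))
              (count-cong L (suc k) ht)

  ≤V-+ : ∀ x y t → (x ≤V t ∧ y ≤V (t ∸V x)) ≡ (x +V y) ≤V t
  ≤V-+ x y t = trans (sym (allUpTo-∧ r _ _)) (allUpTo-cong r (λ p _ _ → ≤ᵇ-+ (x p) (y p) (t p)))

  ∸V-comm : ∀ t x y → ((t ∸V x) ∸V y) ≈ ((t ∸V y) ∸V x)
  ∸V-comm t x y p _ _ = trans (∸-+-assoc (t p) (x p) (y p)) (trans (cong (t p ∸_) (+-comm (x p) (y p))) (sym (∸-+-assoc (t p) (y p) (x p))))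

  remove-pair-comm : (F : Vector → ℕ) → (∀ {w w'} → w ≈ w' → F w ≡ F w') → ∀ x y t →
    (if x ≤V t then (if y ≤V (t ∸V x) then F ((t ∸V x) ∸V y) else 0) else 0)
    ≡ (if y ≤V t then (if x ≤V (t ∸V y) then F ((t ∸V y) ∸V x) else 0) else 0)
  remove-pair-comm F F-cong x y t = begin
      (if x ≤V t then (if y ≤V (t ∸V x) then F ((t ∸V x) ∸V y) else 0) else 0)
        ≡⟨ if-∧ (x ≤V t) _ _ ⟩
      (if x ≤V t ∧ y ≤V (t ∸V x) then F ((t ∸V x) ∸V y) else 0)
        ≡⟨ cong (λ b → if b then F ((t ∸V x) ∸V y) else 0) both-fit ⟩
      (if y ≤V t ∧ x ≤V (t ∸V y) then F ((t ∸V x) ∸V y) else 0)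
        ≡⟨ cong (λ z → if y ≤V t ∧ x ≤V (t ∸V y) then z else 0) (F-cong (∸V-comm t x y)) ⟩
      (if y ≤V t ∧ x ≤V (t ∸V y) then F ((t ∸V y) ∸V x) else 0)
        ≡⟨ sym (if-∧ (y ≤V t) _ _) ⟩
      (if y ≤V t then (if x ≤V (t ∸V y) then F ((t ∸V y) ∸V x) else 0) else 0) ∎
    where
    open ≡-Reasoning
    both-fit : (x ≤V t ∧ y ≤V (t ∸V x)) ≡ (y ≤V t ∧ x ≤V (t ∸V y))
    both-fit = trans (≤V-+ x y t) (trans (≤V-cong (λ p _ _ → +-comm (x p) (y p)) ≈-refl) (sym (≤V-+ y x t)))

  -- x is disjoint from t when some coordinate is 0 in t but not in x; such an
  -- x can never be a part of a multiset with sum t.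
  Disjoint : Vector → Vector → Set
  Disjoint x t = Σ ℕ λ p → (1 ≤ p) × (p ≤ r) × (t p ≡ 0) × (x p ≢ 0)

  Disjoint-≤V : ∀ {x t} → Disjoint x t → x ≤V t ≡ false
  Disjoint-≤V {x} {t} (p , a , b , c , d) = allUpTo-false r _ p a b (≤ᵇ-false (subst (_< x p) (sym c) (n≢0⇒n>0 d)))

  Disjoint-∸V : ∀ {x t} y → Disjoint x t → Disjoint x (t ∸V y)
  Disjoint-∸V {x} {t} y (p , a , b , c , d) = p , a , b , trans (cong (_∸ y p) c) (0∸n≡0 (y p)) , d

  zeroIndicator-0 : ∀ {t} s → 1 ≤ s → s ≤ r → t s ≢ 0 → zeroIndicator t ≡ 0
  zeroIndicator-0 {t} s a b h = cong (λ b → if b then 1 else 0) (allUpTo-false r _ s a b (≡ᵇ-false h))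

  AllDisjoint : (Vector → Bool) → Vector → List Vector → Set
  AllDisjoint keep t L = All (λ x → keep x ≡ false → Disjoint x t) L

  count-bfilter-step : ∀ keep x L k t → (keep x ≡ false → Disjoint x t) →
    count (x ∷ L) (t ∸V x) k ≡ count (bfilter keep (x ∷ L)) (t ∸V x) k →
    count L t (suc k) ≡ count (bfilter keep L) t (suc k) →
    count (x ∷ L) t (suc k) ≡ count (bfilter keep (x ∷ L)) t (suc k)
  count-bfilter-step keep x L k t hx with-x without-x = by-cases (keep x) refl
    where
    by-cases : ∀ b → keep x ≡ b → count (x ∷ L) t (suc k) ≡ count (bfilter keep (x ∷ L)) t (suc k)
    by-cases true eq = trans (cong₂ _+_ (cong (λ z → if x ≤V t then z else 0)
                                              (trans with-x (cong (λ l → count l (t ∸V x) k) (bfilter-keep keep x L eq))))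
                                        without-x)
                             (cong (λ l → count l t (suc k)) (sym (bfilter-keep keep x L eq)))
    by-cases false eq = trans (cong (λ b → (if b then count (x ∷ L) (t ∸V x) k else 0) + count L t (suc k)) (Disjoint-≤V (hx eq)))
                              (trans without-x (cong (λ l → count l t (suc k)) (sym (bfilter-drop keep x L eq))))

  count-bfilter : ∀ keep L k t → AllDisjoint keep t L → count L t k ≡ count (bfilter keep L) t k
  count-bfilter keep L zero t h = refl
  count-bfilter keep [] (suc k) t h = refl
  count-bfilter keep (x ∷ L) (suc k) t (hx ∷ hL) =
    count-bfilter-step keep x L k t hx
      (count-bfilter keep (x ∷ L) k (t ∸V x) (All.map (λ f e → Disjoint-∸V x (f e)) (hx ∷ hL)))
      (count-bfilter keep L (suc k) t hL)

  all-disjoint-at : ∀ s → 1 ≤ s → s ≤ r → ∀ t → t s ≡ 0 → ∀ L → AllDisjoint (λ x → x s ≡ᵇ 0) t L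
  all-disjoint-at s a b t e [] = []
  all-disjoint-at s a b t e (x ∷ L) = (λ f → s , a , b , e , ≡ᵇ-false-sound f) ∷ all-disjoint-at s a b t e L

  -- Splitting a count along a position s at which every available vector has
  -- coordinate 0 or 1.  If t_s = 1, exactly one part has s-coordinate 1; if
  -- t_s = 2, exactly two parts (possibly equal) do.  All other parts come
  -- from the vectors with s-coordinate 0.
  module SplitAt (s : ℕ) (1≤s : 1 ≤ s) (s≤r : s ≤ r) where

    atOne atZero : Vector → Bool
    atOne x = x s ≡ᵇ 1
    atZero x = x s ≡ᵇ 0

    removeOne : List Vector → Vector → ℕ → Vector → ℕ
    removeOne L0 t k x = if x ≤V t then count L0 (t ∸V x) k else 0

    removePair : List Vector → Vector → ℕ → Vector → Vector → ℕ
    removePair L0 t k x y = if x ≤V t then (if y ≤V (t ∸V x) then count L0 ((t ∸V x) ∸V y) k else 0) else 0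

    filters-one : ∀ x L → x s ≡ 1 → ∀ {B : Set} (g : List Vector → List Vector → B) →
      g (bfilter atOne (x ∷ L)) (bfilter atZero (x ∷ L)) ≡ g (x ∷ bfilter atOne L) (bfilter atZero L)
    filters-one x L e g = cong₂ g (bfilter-keep atOne x L (cong (_≡ᵇ 1) e)) (bfilter-drop atZero x L (cong (_≡ᵇ 0) e))

    filters-zero : ∀ x L → x s ≡ 0 → ∀ {B : Set} (g : List Vector → List Vector → B) →
      g (bfilter atOne (x ∷ L)) (bfilter atZero (x ∷ L)) ≡ g (bfilter atOne L) (x ∷ bfilter atZero L)
    filters-zero x L e g = cong₂ g (bfilter-drop atOne x L (cong (_≡ᵇ 1) e)) (bfilter-keep atZero x L (cong (_≡ᵇ 0) e))

    count-split-unit : ∀ L → All (λ x → x s ≤ 1) L → ∀ k t → t s ≡ 1 →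
      count L t (suc k) ≡ sumOver (bfilter atOne L) (removeOne (bfilter atZero L) t k)
    count-split-unit [] h k t ht = refl
    count-split-unit (x ∷ L) (hx ∷ hL) k t ht with ≤1-cases hx
    ... | inj₂ e = trans (cong₂ _+_
           (cong (λ z → if x ≤V t then z else 0)
                 (trans (count-bfilter atZero (x ∷ L) k (t ∸V x) (all-disjoint-at s 1≤s s≤r (t ∸V x) (cong₂ _∸_ ht e) (x ∷ L)))
                        (cong (λ l → count l (t ∸V x) k) (bfilter-drop atZero x L (cong (_≡ᵇ 0) e)))))
           (count-split-unit L hL k t ht))
           (sym (filters-one x L e (λ l l' → sumOver l (removeOne l' t k))))
    count-split-unit (x ∷ L) (hx ∷ hL) zero t ht | inj₁ e =
      trans (cong (_+ count L t 1) (trans (cong (λ z → if x ≤V t then z else 0)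
                                                (zeroIndicator-0 {t ∸V x} s 1≤s s≤r (λ q → 0≢1+n (trans (sym q) (cong₂ _∸_ ht e)))))
                                          (if-0 (x ≤V t))))
            (trans (count-split-unit L hL zero t ht) (sym (filters-zero x L e (λ l l' → sumOver l (removeOne l' t zero)))))
    count-split-unit (x ∷ L) (hx ∷ hL) (suc k) t ht | inj₁ e = begin
        (if x ≤V t then count (x ∷ L) (t ∸V x) (suc k) else 0) + count L t (suc (suc k))
          ≡⟨ cong₂ _+_ (cong (λ z → if x ≤V t then z else 0) (count-split-unit (x ∷ L) (hx ∷ hL) k (t ∸V x) (cong₂ _∸_ ht e)))
                       (count-split-unit L hL (suc k) t ht) ⟩
        (if x ≤V t then sumOver (bfilter atOne (x ∷ L)) (removeOne (bfilter atZero (x ∷ L)) (t ∸V x) k) else 0) + rest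
          ≡⟨ cong (λ z → (if x ≤V t then z else 0) + rest) (filters-zero x L e (λ l l' → sumOver l (removeOne l' (t ∸V x) k))) ⟩
        (if x ≤V t then sumOver M (removeOne (x ∷ L0) (t ∸V x) k) else 0) + rest
          ≡⟨ cong (_+ rest) (sumOver-if M (x ≤V t) _) ⟩
        sumOver M (λ y → if x ≤V t then removeOne (x ∷ L0) (t ∸V x) k y else 0) + rest
          ≡⟨ cong (_+ rest) (sumOver-cong M (λ y → remove-pair-comm (λ w → count (x ∷ L0) w k) (count-cong (x ∷ L0) k) x y t)) ⟩
        sumOver M (λ y → if y ≤V t then (if x ≤V (t ∸V y) then count (x ∷ L0) ((t ∸V y) ∸V x) k else 0) else 0) + rest
          ≡⟨ sym (sumOver-+ M _ _) ⟩
        sumOver M (λ y → (if y ≤V t then (if x ≤V (t ∸V y) then count (x ∷ L0) ((t ∸V y) ∸V x) k else 0) else 0) + removeOne L0 t (suc k) y)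
          ≡⟨ sumOver-cong M (λ y → sym (if-+ (y ≤V t) _ _)) ⟩
        sumOver M (removeOne (x ∷ L0) t (suc k))
          ≡⟨ sym (filters-zero x L e (λ l l' → sumOver l (removeOne l' t (suc k)))) ⟩
        sumOver (bfilter atOne (x ∷ L)) (removeOne (bfilter atZero (x ∷ L)) t (suc k)) ∎
      where
      open ≡-Reasoning
      M = bfilter atOne L
      L0 = bfilter atZero L
      rest = sumOver M (removeOne L0 t (suc k))

    count-one-at-two : ∀ L → All (λ x → x s ≤ 1) L → ∀ t → t s ≡ 2 → count L t 1 ≡ 0
    count-one-at-two [] h t ht = refl
    count-one-at-two (x ∷ L) (hx ∷ hL) t ht =
      cong₂ _+_ (trans (cong (λ z → if x ≤V t then z else 0) (zeroIndicator-0 {t ∸V x} s 1≤s s≤r remainder≢0)) (if-0 (x ≤V t)))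
                (count-one-at-two L hL t ht)
      where
      remainder≢0 : t s ∸ x s ≢ 0
      remainder≢0 q with ≤1-cases hx
      ... | inj₁ e = 0≢1+n (trans (sym q) (cong₂ _∸_ ht e))
      ... | inj₂ e = 0≢1+n (trans (sym q) (cong₂ _∸_ ht e))

    count-split-two : ∀ L → All (λ x → x s ≤ 1) L → ∀ k t → t s ≡ 2 →
      count L t (suc (suc k)) ≡ pairSum (bfilter atOne L) (removePair (bfilter atZero L) t k)
    count-split-two [] h k t ht = refl
    count-split-two (x ∷ L) (hx ∷ hL) k t ht with ≤1-cases hx
    ... | inj₂ e = trans (cong₂ _+_
           (trans (cong (λ z → if x ≤V t then z else 0)
                        (trans (count-split-unit (x ∷ L) (hx ∷ hL) k (t ∸V x) (cong₂ _∸_ ht e))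
                               (filters-one x L e (λ l l' → sumOver l (removeOne l' (t ∸V x) k)))))
                  (sumOver-if (x ∷ bfilter atOne L) (x ≤V t) _))
           (count-split-two L hL k t ht))
           (sym (filters-one x L e (λ l l' → pairSum l (removePair l' t k))))
    count-split-two (x ∷ L) (hx ∷ hL) zero t ht | inj₁ e =
      trans (cong (_+ count L t 2) (trans (cong (λ z → if x ≤V t then z else 0) (count-one-at-two (x ∷ L) (hx ∷ hL) (t ∸V x) (cong₂ _∸_ ht e)))
                                          (if-0 (x ≤V t))))
            (trans (count-split-two L hL zero t ht) (sym (filters-zero x L e (λ l l' → pairSum l (removePair l' t zero)))))
    count-split-two (x ∷ L) (hx ∷ hL) (suc k) t ht | inj₁ e = begin
        (if x ≤V t then count (x ∷ L) (t ∸V x) (suc (suc k)) else 0) + count L t (suc (suc (suc k)))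
          ≡⟨ cong₂ _+_ (cong (λ z → if x ≤V t then z else 0) (count-split-two (x ∷ L) (hx ∷ hL) k (t ∸V x) (cong₂ _∸_ ht e)))
                       (count-split-two L hL (suc k) t ht) ⟩
        (if x ≤V t then pairSum (bfilter atOne (x ∷ L)) (removePair (bfilter atZero (x ∷ L)) (t ∸V x) k) else 0) + rest
          ≡⟨ cong (λ z → (if x ≤V t then z else 0) + rest) (filters-zero x L e (λ l l' → pairSum l (removePair l' (t ∸V x) k))) ⟩
        (if x ≤V t then pairSum M (removePair (x ∷ L0) (t ∸V x) k) else 0) + rest
          ≡⟨ cong (_+ rest) (pairSum-if M (x ≤V t) _) ⟩
        pairSum M (λ y z → if x ≤V t then removePair (x ∷ L0) (t ∸V x) k y z else 0) + rest
          ≡⟨ cong (_+ rest) (pairSum-cong M x-last) ⟩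
        pairSum M (λ y z → if y ≤V t then (if z ≤V (t ∸V y) then removeX ((t ∸V y) ∸V z) else 0) else 0) + rest
          ≡⟨ sym (pairSum-+ M _ _) ⟩
        pairSum M (λ y z → (if y ≤V t then (if z ≤V (t ∸V y) then removeX ((t ∸V y) ∸V z) else 0) else 0) + removePair L0 t (suc k) y z)
          ≡⟨ pairSum-cong M (λ y z → trans (sym (if-+ (y ≤V t) _ _)) (cong (λ w → if y ≤V t then w else 0) (sym (if-+ (z ≤V (t ∸V y)) _ _)))) ⟩
        pairSum M (removePair (x ∷ L0) t (suc k))
          ≡⟨ sym (filters-zero x L e (λ l l' → pairSum l (removePair l' t (suc k)))) ⟩
        pairSum (bfilter atOne (x ∷ L)) (removePair (bfilter atZero (x ∷ L)) t (suc k)) ∎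
      where
      open ≡-Reasoning
      M = bfilter atOne L
      L0 = bfilter atZero L
      rest = pairSum M (removePair L0 t (suc k))
      removeX : Vector → ℕ
      removeX w = if x ≤V w then count (x ∷ L0) (w ∸V x) k else 0
      removeThen : Vector → Vector → ℕ
      removeThen z w = if z ≤V w then count (x ∷ L0) (w ∸V z) k else 0
      removeThen-cong : ∀ z {w w'} → w ≈ w' → removeThen z w ≡ removeThen z w'
      removeThen-cong z {w} {w'} h = cong₂ (λ b n → if b then n else 0) (≤V-cong {z} {z} {w} {w'} ≈-refl h)
                                           (count-cong (x ∷ L0) k (∸V-cong {w} {w'} {z} {z} h ≈-refl))
      x-last : ∀ y z → (if x ≤V t then removePair (x ∷ L0) (t ∸V x) k y z else 0)
                     ≡ (if y ≤V t then (if z ≤V (t ∸V y) then removeX ((t ∸V y) ∸V z) else 0) else 0)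
      x-last y z = trans (remove-pair-comm (removeThen z) (removeThen-cong z) x y t)
                         (cong (λ w → if y ≤V t then w else 0) (remove-pair-comm (λ w → count (x ∷ L0) w k) (count-cong (x ∷ L0) k) x z (t ∸V y)))

-- coefficient i (counted from 0) of a coefficient list, 0 beyond its end
coeff : List ℕ → ℕ → ℕ
coeff [] i = 0
coeff (a ∷ as) zero = a
coeff (a ∷ as) (suc i) = coeff as i

-- a coefficient list as a function on the positions 1, 2, …
toVector : List ℕ → Vector
toVector v p = coeff v (p ∸ 1)

length-filter : ∀ {A : Set} {P : A → Set} (P? : Decidable P) xs → length (filter P? xs) ≡ sumOver xs (λ a → if does (P? a) then 1 else 0)
length-filter P? [] = refl
length-filter P? (x ∷ xs) with does (P? x)
... | true = cong suc (length-filter P? xs)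
... | false = length-filter P? xs

_≤L_ : List ℕ → List ℕ → Bool
[] ≤L [] = true
(a ∷ x) ≤L (c ∷ t) = (a ≤ᵇ c) ∧ (x ≤L t)
_ ≤L _ = false

≤L-allUpTo : ∀ x t → length x ≡ length t → x ≤L t ≡ allUpTo (length t) (λ p → toVector x p ≤ᵇ toVector t p)
≤L-allUpTo [] [] e = refl
≤L-allUpTo (a ∷ x) (c ∷ t) e = trans (cong ((a ≤ᵇ c) ∧_) (≤L-allUpTo x t (suc-injective e)))
  (trans (cong ((a ≤ᵇ c) ∧_) (allUpTo-cong (length t) (λ { (suc p) _ _ → refl })))
  (sym (allUpTo-cons (length t) (λ p → toVector (a ∷ x) p ≤ᵇ toVector (c ∷ t) p))))

zero-list-test : ∀ n t → length t ≡ n → does (≡-dec ℕ._≟_ (replicate n 0) t) ≡ allUpTo n (λ p → toVector t p ≡ᵇ 0)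
zero-list-test zero [] e = refl
zero-list-test (suc n) (c ∷ t) e = trans (cong₂ _∧_ (≡ᵇ-comm 0 c) (zero-list-test n t (suc-injective e)))
  (trans (cong ((c ≡ᵇ 0) ∧_) (allUpTo-cong n (λ { (suc p) _ _ → refl })))
  (sym (allUpTo-cons n (λ p → toVector (c ∷ t) p ≡ᵇ 0))))

-- x + s = t  iff  x ≤ t and s = t ∸ x  (s may be shorter, as vsum produces)
sum-list-test : ∀ x s t → length x ≡ length t → length s ≤ length t →
  does (≡-dec ℕ._≟_ (zipWith _+_ x s) t) ≡ (x ≤L t ∧ does (≡-dec ℕ._≟_ s (zipWith _∸_ t x)))
sum-list-test [] [] [] e h = refl
sum-list-test (a ∷ x) [] (c ∷ t) e h = sym (∧-zeroʳ _)
sum-list-test (a ∷ x) (b ∷ s) (c ∷ t) e (s≤s h) =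
  trans (cong₂ _∧_ (≡ᵇ-+ a b c) (sum-list-test x s t (suc-injective e) h)) (∧-interchange (a ≤ᵇ c) (b ≡ᵇ c ∸ a) _ _)

coeff-zipWith-∸ : ∀ a b → length a ≡ length b → ∀ i → coeff (zipWith _∸_ a b) i ≡ coeff a i ∸ coeff b i
coeff-zipWith-∸ [] [] e i = refl
coeff-zipWith-∸ (x ∷ a) (y ∷ b) e zero = refl
coeff-zipWith-∸ (x ∷ a) (y ∷ b) e (suc i) = coeff-zipWith-∸ a b (suc-injective e) i

length-zipWith : ∀ (f : ℕ → ℕ → ℕ) a b → length a ≡ length b → length (zipWith f a b) ≡ length a
length-zipWith f [] [] e = refl
length-zipWith f (x ∷ a) (y ∷ b) e = cong suc (length-zipWith f a b (suc-injective e))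

length-zipWith-≤ : ∀ (f : ℕ → ℕ → ℕ) a b → length (zipWith f a b) ≤ length b
length-zipWith-≤ f [] b = z≤n
length-zipWith-≤ f (x ∷ a) [] = z≤n
length-zipWith-≤ f (x ∷ a) (y ∷ b) = s≤s (length-zipWith-≤ f a b)

length-vsum : ∀ r m → length (vsum r m) ≤ r
length-vsum r [] = ≤-reflexive (ListP.length-replicate r)
length-vsum r (x ∷ m) = ≤-trans (length-zipWith-≤ _+_ x (vsum r m)) (length-vsum r m)

module FromLists (r : ℕ) where
  open Multisets r

  sumsTo : List ℕ → List (List ℕ) → Bool
  sumsTo t m = does (≡-dec ℕ._≟_ (vsum r m) t)

  matches : List (List ℕ) → ℕ → List ℕ → ℕ
  matches Ls k t = sumOver (multisets Ls k) (λ m → if sumsTo t m then 1 else 0)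

  matches-zero : ∀ t → length t ≡ r → matches [] 0 t ≡ zeroIndicator (toVector t)
  matches-zero t e = trans (+-identityʳ _) (cong (λ b → if b then 1 else 0) (zero-list-test r t e))

  -- Both counts obey the same recursion on the list of available vectors.
  matches-count : ∀ Ls → All (λ x → length x ≡ r) Ls → ∀ k t → length t ≡ r →
    matches Ls k t ≡ count (map toVector Ls) (toVector t) k
  matches-count [] h zero t e = matches-zero t e
  matches-count (x ∷ Ls) h zero t e = matches-zero t e
  matches-count [] h (suc k) t e = refl
  matches-count (x ∷ Ls) (hx ∷ hL) (suc k) t e = begin
      sumOver (map (x ∷_) (multisets (x ∷ Ls) k) ++ multisets Ls (suc k)) hit
        ≡⟨ sumOver-++ (map (x ∷_) (multisets (x ∷ Ls) k)) (multisets Ls (suc k)) hit ⟩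
      sumOver (map (x ∷_) (multisets (x ∷ Ls) k)) hit + matches Ls (suc k) t
        ≡⟨ cong₂ _+_ (sumOver-map (x ∷_) (multisets (x ∷ Ls) k) hit) (matches-count Ls hL (suc k) t e) ⟩
      sumOver (multisets (x ∷ Ls) k) (λ m → hit (x ∷ m)) + rest
        ≡⟨ cong (_+ rest) (sumOver-cong (multisets (x ∷ Ls) k) split-x) ⟩
      sumOver (multisets (x ∷ Ls) k) (λ m → if x ≤L t then (if sumsTo t' m then 1 else 0) else 0) + rest
        ≡⟨ cong (_+ rest) (sym (sumOver-if (multisets (x ∷ Ls) k) (x ≤L t) _)) ⟩
      (if x ≤L t then matches (x ∷ Ls) k t' else 0) + rest
        ≡⟨ cong (_+ rest) (cong₂ (λ b n → if b then n else 0) fits remainder) ⟩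
      count (map toVector (x ∷ Ls)) (toVector t) (suc k) ∎
    where
    open ≡-Reasoning
    hit : List (List ℕ) → ℕ
    hit m = if sumsTo t m then 1 else 0
    t' = zipWith _∸_ t x
    rest = count (map toVector Ls) (toVector t) (suc k)
    split-x : ∀ m → hit (x ∷ m) ≡ (if x ≤L t then (if sumsTo t' m then 1 else 0) else 0)
    split-x m = trans (cong (λ b → if b then 1 else 0)
                            (sum-list-test x (vsum r m) t (trans hx (sym e)) (subst (length (vsum r m) ≤_) (sym e) (length-vsum r m))))
                      (sym (if-∧ (x ≤L t) _ 1))
    fits : x ≤L t ≡ toVector x ≤V toVector t
    fits = trans (≤L-allUpTo x t (trans hx (sym e))) (cong (λ n → allUpTo n (λ p → toVector x p ≤ᵇ toVector t p)) e)
    remainder : matches (x ∷ Ls) k t' ≡ count (map toVector (x ∷ Ls)) (toVector t ∸V toVector x) k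
    remainder = trans (matches-count (x ∷ Ls) (hx ∷ hL) k t' (trans (length-zipWith _∸_ t x (trans e (sym hx))) e))
                      (count-cong (map toVector (x ∷ Ls)) k (λ p _ _ → coeff-zipWith-∸ t x (trans e (sym hx)) (p ∸ 1)))

  numPartitions≡count : ∀ k → All (λ x → length x ≡ r) (positiveRoots r) → length (highestRoot r) ≡ r →
    numPartitions r k ≡ count (map toVector (positiveRoots r)) (toVector (highestRoot r)) k
  numPartitions≡count k h e = trans (length-filter _ (multisets (positiveRoots r) k)) (matches-count (positiveRoots r) h k (highestRoot r) e)

trichotomy : ∀ p u v → u ≤ v → (p ≤ u) ⊎ ((u < p × p ≤ v) ⊎ (v < p))
trichotomy p u v h with p ≤? u
... | yes a = inj₁ a
... | no a with p ≤? v
...   | yes b = inj₂ (inj₁ (≰⇒> a , b))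
...   | no b = inj₂ (inj₂ (≰⇒> b))

interval : ℕ → ℕ → Vector
interval i j p = if between i j p then 1 else 0

interval-in : ∀ {i j p} → i ≤ p → p ≤ j → interval i j p ≡ 1
interval-in a b rewrite ≤ᵇ-true a | ≤ᵇ-true b = refl

interval-below : ∀ {i j p} → p < i → interval i j p ≡ 0
interval-below a rewrite ≤ᵇ-false a = refl

interval-above : ∀ {i j p} → j < p → interval i j p ≡ 0
interval-above {i} {j} {p} a rewrite ≤ᵇ-false a = cong (λ b → if b then 1 else 0) (∧-zeroʳ (i ≤ᵇ p))

interval-at-end : ∀ {i j} → i ≤ j → 0 < interval i j j
interval-at-end {i} {j} i≤j = subst (0 <_) (sym (interval-in {i} {j} {j} i≤j ≤-refl)) (s≤s z≤n)

interval-≤1 : ∀ i j p → interval i j p ≤ 1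
interval-≤1 i j p with between i j p
... | true = ≤-refl
... | false = z≤n

shape : ℕ → ℕ → Vector
shape u v p = if p ≤ᵇ u then 2 else (if p ≤ᵇ v then 1 else 0)

shape-two : ∀ {u v p} → p ≤ u → shape u v p ≡ 2
shape-two a rewrite ≤ᵇ-true a = refl

shape-one : ∀ {u v p} → u < p → p ≤ v → shape u v p ≡ 1
shape-one a b rewrite ≤ᵇ-false a | ≤ᵇ-true b = refl

shape-zero : ∀ {u v p} → u < p → v < p → shape u v p ≡ 0
shape-zero a b rewrite ≤ᵇ-false a | ≤ᵇ-false b = refl

shape-≥1 : ∀ {u v p} → p ≤ v → 1 ≤ shape u v p
shape-≥1 {u} {v} {p} h with p ≤ᵇ u
... | true = s≤s z≤n
... | false rewrite ≤ᵇ-true h = ≤-refl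

shape∸long-interval : ∀ i a s → 1 ≤ i → i ≤ a → a < s → ∀ p → shape a s p ∸ interval i s p ≡ shape (i ∸ 1) a p
shape∸long-interval (suc u) a s _ u<a a<s p with trichotomy p u a (<⇒≤ u<a)
... | inj₁ p≤u =
  trans (cong₂ _∸_ (shape-two (≤-trans p≤u (<⇒≤ u<a))) (interval-below {suc u} {s} (s≤s p≤u))) (sym (shape-two p≤u))
... | inj₂ (inj₁ (u<p , p≤a)) =
  trans (cong₂ _∸_ (shape-two p≤a) (interval-in {suc u} {s} u<p (≤-trans p≤a (<⇒≤ a<s)))) (sym (shape-one u<p p≤a))
... | inj₂ (inj₂ a<p) with p ≤? s
...   | yes p≤s = trans (cong₂ _∸_ (shape-one a<p p≤s) (interval-in {suc u} {s} (<-trans u<a a<p) p≤s)) (sym (shape-zero (<-trans u<a a<p) a<p))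
...   | no p≰s = trans (cong₂ _∸_ (shape-zero a<p (≰⇒> p≰s)) (interval-above {suc u} {s} (≰⇒> p≰s))) (sym (shape-zero (<-trans u<a a<p) a<p))

shape∸short-interval : ∀ i a s → a < i → i ≤ s → ∀ p → shape a s p ∸ interval i s p ≡ shape a (i ∸ 1) p
shape∸short-interval (suc u) a s (s≤s a≤u) u<s p with trichotomy p a u a≤u
... | inj₁ p≤a =
  trans (cong₂ _∸_ (shape-two p≤a) (interval-below {suc u} {s} (s≤s (≤-trans p≤a a≤u)))) (sym (shape-two p≤a))
... | inj₂ (inj₁ (a<p , p≤u)) =
  trans (cong₂ _∸_ (shape-one a<p (≤-trans p≤u (<⇒≤ u<s))) (interval-below {suc u} {s} (s≤s p≤u))) (sym (shape-one a<p p≤u))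
... | inj₂ (inj₂ u<p) with p ≤? s
...   | yes p≤s = trans (cong₂ _∸_ (shape-one (≤-<-trans a≤u u<p) p≤s) (interval-in {suc u} {s} u<p p≤s)) (sym (shape-zero (≤-<-trans a≤u u<p) u<p))
...   | no p≰s = trans (cong₂ _∸_ (shape-zero (≤-<-trans a≤u u<p) (≰⇒> p≰s)) (interval-above {suc u} {s} (≰⇒> p≰s)))
                       (sym (shape-zero (≤-<-trans a≤u u<p) u<p))

shape∸two-intervals : ∀ i i' a → 1 ≤ i → i ≤ i' → i' ≤ a → ∀ p → (shape a a p ∸ interval i a p) ∸ interval i' a p ≡ shape (i ∸ 1) (i' ∸ 1) p
shape∸two-intervals (suc u) (suc v) a _ (s≤s u≤v) v<a p with trichotomy p u v u≤v
... | inj₁ p≤u = trans (cong₂ _∸_ (cong₂ _∸_ (shape-two p≤a) (interval-below {suc u} {a} (s≤s p≤u))) (interval-below {suc v} {a} (s≤s (≤-trans p≤u u≤v))))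
                       (sym (shape-two p≤u))
  where
  p≤a : p ≤ a
  p≤a = ≤-trans p≤u (≤-trans u≤v (<⇒≤ v<a))
... | inj₂ (inj₁ (u<p , p≤v)) = trans (cong₂ _∸_ (cong₂ _∸_ (shape-two p≤a) (interval-in {suc u} {a} u<p p≤a)) (interval-below {suc v} {a} (s≤s p≤v)))
                                      (sym (shape-one u<p p≤v))
  where
  p≤a : p ≤ a
  p≤a = ≤-trans p≤v (<⇒≤ v<a)
... | inj₂ (inj₂ v<p) with p ≤? a
...   | yes p≤a = trans (cong₂ _∸_ (cong₂ _∸_ (shape-two p≤a) (interval-in {suc u} {a} (≤-<-trans u≤v v<p) p≤a)) (interval-in {suc v} {a} v<p p≤a))
                        (sym (shape-zero (≤-<-trans u≤v v<p) v<p))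
...   | no p≰a = trans (cong₂ _∸_ (cong₂ _∸_ (shape-zero (≰⇒> p≰a) (≰⇒> p≰a)) (interval-above {suc u} {a} (≰⇒> p≰a))) (interval-above {suc v} {a} (≰⇒> p≰a)))
                       (sym (shape-zero (≤-<-trans u≤v v<p) v<p))

pred+suc∸ : ∀ i a → 1 ≤ i → i ≤ a → (i ∸ 1) + suc (a ∸ i) ≡ a
pred+suc∸ (suc i) a _ h = trans (+-suc i (a ∸ suc i)) (m+[n∸m]≡n h)

pred+∸ : ∀ i j → 1 ≤ i → i ≤ j → (i ∸ 1) + (j ∸ i) ≡ j ∸ 1
pred+∸ (suc i) (suc j) _ (s≤s h) = m+[n∸m]≡n h

coeff-map : ∀ (f : ℕ → ℕ) xs i → i < length xs → coeff (map f xs) i ≡ f (coeff xs i)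
coeff-map f (x ∷ xs) zero h = refl
coeff-map f (x ∷ xs) (suc i) (s≤s h) = coeff-map f xs i h

coeff-upTo : ∀ n i → i < n → coeff (upTo n) i ≡ i
coeff-upTo n i = go id n i
  where
  go : ∀ (h : ℕ → ℕ) n i → i < n → coeff (applyUpTo h n) i ≡ h i
  go h (suc n) zero _ = refl
  go h (suc n) (suc i) (s≤s l) = go (λ x → h (suc x)) n i l
  id : ℕ → ℕ
  id x = x

length-range1 : ∀ r → length (range1 r) ≡ r
length-range1 r = trans (ListP.length-map suc (upTo r)) (ListP.length-applyUpTo (λ i → i) r)

length-mkRoot : ∀ r f → length (mkRoot r f) ≡ r
length-mkRoot r f = trans (ListP.length-map f (range1 r)) (length-range1 r)

toVector-mkRoot : ∀ r f p → 1 ≤ p → p ≤ r → toVector (mkRoot r f) p ≡ f p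
toVector-mkRoot r f (suc p) _ (s≤s p≤r) =
  trans (coeff-map f (range1 r) p (subst (p <_) (sym (length-range1 r)) (s≤s p≤r)))
        (cong f (trans (coeff-map suc (upTo r) p (subst (p <_) (sym (ListP.length-applyUpTo (λ i → i) r)) (s≤s p≤r)))
                       (cong suc (coeff-upTo r p (s≤s p≤r)))))

coeff-map-≤1 : ∀ (f : ℕ → ℕ) → (∀ q → f q ≤ 1) → ∀ xs i → coeff (map f xs) i ≤ 1
coeff-map-≤1 f h [] i = z≤n
coeff-map-≤1 f h (x ∷ xs) zero = h x
coeff-map-≤1 f h (x ∷ xs) (suc i) = coeff-map-≤1 f h xs i

range1-bounds : ∀ n → All (λ i → 1 ≤ i × i ≤ n) (range1 n)
range1-bounds n = AllP.map⁺ (AllP.applyUpTo⁺₁ (λ i → i) n (λ {i} l → s≤s z≤n , l))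

All-filter : ∀ {A : Set} {P : A → Set} (Q? : Decidable P) {R : A → Set} xs → All R xs → All (λ a → R a × does (Q? a) ≡ true) (filter Q? xs)
All-filter Q? [] [] = []
All-filter Q? (x ∷ xs) (rx ∷ rs) with does (Q? x) in eq
... | true = (rx , eq) ∷ All-filter Q? xs rs
... | false = All-filter Q? xs rs

All-concatMap : ∀ {A B : Set} {P : B → Set} (g : A → List B) xs → All (λ a → All P (g a)) xs → All P (concatMap g xs)
All-concatMap g xs h = AllP.concat⁺ (AllP.map⁺ h)

All-bfilter : ∀ {A : Set} {P : A → Set} (p : A → Bool) xs → All (λ x → p x ≡ true → P x) xs → All P (bfilter p xs)
All-bfilter p [] [] = []
All-bfilter p (x ∷ xs) (h ∷ hs) with p x in eq
... | true = h refl ∷ All-bfilter p xs hs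
... | false = All-bfilter p xs hs

sumOver-family : ∀ {A : Set} m (root : ℕ → ℕ → A) {P : ℕ → ℕ → Set} (P? : ∀ i → Decidable (P i)) f →
  sumOver (concatMap (λ i → map (root i) (filter (P? i) (range1 m))) (range1 m)) f
  ≡ sumTo m (λ i → sumTo m (λ j → if does (P? i j) then f (root i j) else 0))
sumOver-family m root P? f =
  trans (sumOver-concatMap (λ i → map (root i) (filter (P? i) (range1 m))) (range1 m) f)
        (trans (sumOver-range1 m _) (sumTo-cong m (λ i _ _ →
          trans (sumOver-map (root i) (filter (P? i) (range1 m)) f)
                (trans (sumOver-filter (P? i) (range1 m) (λ j → f (root i j))) (sumOver-range1 m _)))))

module RootsC (n : ℕ) where
  r : ℕ
  r = suc n
  open Multisets r

  rootBV : ℕ → ℕ → Vector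
  rootBV i j p = if p ≡ᵇ r then 1 else if between j (r ∸ 1) p then 2 else if between i (j ∸ 1) p then 1 else 0
  rootCV : ℕ → Vector
  rootCV i p = if p ≡ᵇ r then 1 else if between i (r ∸ 1) p then 2 else 0
  highestV : Vector
  highestV p = if p ≡ᵇ r then 1 else 2

  roots : List (List ℕ)
  roots = positiveRoots r

  -- the roots with α_r-coefficient 0: the intervals α_i + ⋯ + α_j, j < r
  intervalRoots : List Vector
  intervalRoots = bfilter (λ x → x r ≡ᵇ 0) (map toVector roots)

  highestVec : Vector
  highestVec = toVector (highestRoot r)

  highestVec≈ : highestVec ≈ highestV
  highestVec≈ p a b = toVector-mkRoot r _ p a b
  rootA≈ : ∀ i j → toVector (rootA r i j) ≈ interval i j
  rootA≈ i j p a b = toVector-mkRoot r _ p a b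
  rootB≈ : ∀ i j → toVector (rootB r i j) ≈ rootBV i j
  rootB≈ i j p a b = toVector-mkRoot r _ p a b
  rootC≈ : ∀ i → toVector (rootC r i) ≈ rootCV i
  rootC≈ i p a b = toVector-mkRoot r _ p a b

  sum-over-roots : ∀ g → Respects≈ g → sumOver (map toVector roots) g ≡
       sumTo r (λ i → sumTo r (λ j → if i ≤ᵇ j then g (interval i j) else 0))
       + (sumTo n (λ i → sumTo n (λ j → if suc i ≤ᵇ j then g (rootBV i j) else 0)) + sumTo n (λ i → g (rootCV i)))
  sum-over-roots g g-cong = begin
      sumOver (map toVector roots) g                      ≡⟨ sumOver-map toVector roots g ⟩
      sumOver (As ++ (Bs ++ Cs)) g′                       ≡⟨ sumOver-++ As (Bs ++ Cs) g′ ⟩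
      sumOver As g′ + sumOver (Bs ++ Cs) g′               ≡⟨ cong (sumOver As g′ +_) (sumOver-++ Bs Cs g′) ⟩
      sumOver As g′ + (sumOver Bs g′ + sumOver Cs g′)     ≡⟨ cong₂ _+_ sumA (cong₂ _+_ sumB sumC) ⟩
      _ ∎
    where
    open ≡-Reasoning
    g′ : List ℕ → ℕ
    g′ x = g (toVector x)
    As = concatMap (λ i → map (rootA r i) (filter (λ j → i ≤? j) (range1 r))) (range1 r)
    Bs = concatMap (λ i → map (rootB r i) (filter (λ j → i ℕ.<? j) (range1 n))) (range1 n)
    Cs = map (rootC r) (range1 n)
    sumA = trans (sumOver-family r (rootA r) (λ i j → i ≤? j) g′)
                 (sumTo-cong r (λ i _ _ → sumTo-cong r (λ j _ _ → cong (λ z → if i ≤ᵇ j then z else 0) (g-cong (rootA≈ i j)))))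
    sumB = trans (sumOver-family n (rootB r) (λ i j → i ℕ.<? j) g′)
                 (sumTo-cong n (λ i _ _ → sumTo-cong n (λ j _ _ → cong (λ z → if suc i ≤ᵇ j then z else 0) (g-cong (rootB≈ i j)))))
    sumC = trans (sumOver-map (rootC r) (range1 n) g′) (trans (sumOver-range1 n _) (sumTo-cong n (λ i _ _ → g-cong (rootC≈ i))))

  all-roots : ∀ (P : List ℕ → Set) → (∀ i j → 1 ≤ i → i ≤ r → i ≤ j → j ≤ r → P (rootA r i j)) →
    (∀ i j → P (rootB r i j)) → (∀ i → P (rootC r i)) → All P roots
  all-roots P hA hB hC = AllP.++⁺ allA (AllP.++⁺ allB allC)
    where
    allA = All-concatMap _ (range1 r) (All.map (λ {i} (1≤i , i≤r) → AllP.map⁺ (All.map (λ {j} ((_ , j≤r) , i≤j) → hA i j 1≤i i≤r (≤ᵇ-sound i≤j) j≤r)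
                                                                                     (All-filter (λ j → i ≤? j) (range1 r) (range1-bounds r))))
                                            (range1-bounds r))
    allB = All-concatMap _ (range1 n) (All.tabulate (λ {i} _ → AllP.map⁺ (All.tabulate (λ {j} _ → hB i j))))
    allC = AllP.map⁺ (All.tabulate (λ {i} _ → hC i))

  all-root-vectors : ∀ (P : Vector → Set) → (∀ i j → 1 ≤ i → i ≤ r → i ≤ j → j ≤ r → P (toVector (rootA r i j))) →
    (∀ i j → P (toVector (rootB r i j))) → (∀ i → P (toVector (rootC r i))) → All P (map toVector roots)
  all-root-vectors P hA hB hC = AllP.map⁺ (all-roots (λ x → P (toVector x)) hA hB hC)

  length-roots : All (λ x → length x ≡ r) roots
  length-roots = all-roots _ (λ i j _ _ _ _ → length-mkRoot r _) (λ i j → length-mkRoot r _) (λ i → length-mkRoot r _)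

  highest-last : highestV r ≡ 1
  highest-last rewrite ≡ᵇ-true {r} refl = refl

  highest-below : ∀ {p} → p < r → highestV p ≡ 2
  highest-below {p} h rewrite ≡ᵇ-false {p} {r} (<⇒≢ h) = refl

  highest-≥1 : ∀ p → 1 ≤ highestV p
  highest-≥1 p with p ≡ᵇ r
  ... | true = ≤-refl
  ... | false = s≤s z≤n

  rootB-last : ∀ i j → rootBV i j r ≡ 1
  rootB-last i j rewrite ≡ᵇ-true {r} refl = refl
  rootC-last : ∀ i → rootCV i r ≡ 1
  rootC-last i rewrite ≡ᵇ-true {r} refl = refl

  rootB≤highest : ∀ i j p → rootBV i j p ≤ highestV p
  rootB≤highest i j p with p ≡ᵇ r
  ... | true = ≤-refl
  ... | false with between j (r ∸ 1) p
  ...   | true = ≤-refl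
  ...   | false with between i (j ∸ 1) p
  ...     | true = s≤s z≤n
  ...     | false = z≤n

  rootC≤highest : ∀ i p → rootCV i p ≤ highestV p
  rootC≤highest i p with p ≡ᵇ r
  ... | true = ≤-refl
  ... | false with between i (r ∸ 1) p
  ...   | true = ≤-refl
  ...   | false = z≤n

  interval-fits-highest : ∀ i → (interval i r) ≤V highestV ≡ true
  interval-fits-highest i = ≤V-intro _ _ (λ p _ _ → ≤-trans (interval-≤1 i r p) (highest-≥1 p))
  rootB-fits-highest : ∀ i j → (rootBV i j) ≤V highestV ≡ true
  rootB-fits-highest i j = ≤V-intro _ _ (λ p _ _ → rootB≤highest i j p)
  rootC-fits-highest : ∀ i → (rootCV i) ≤V highestV ≡ true
  rootC-fits-highest i = ≤V-intro _ _ (λ p _ _ → rootC≤highest i p)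

  highest∸interval : ∀ i → 1 ≤ i → i ≤ r → (highestV ∸V interval i r) ≈ shape (i ∸ 1) n
  highest∸interval (suc u) _ (s≤s u≤n) p _ p≤r with trichotomy p u n u≤n
  ... | inj₁ p≤u = trans (cong₂ _∸_ (highest-below (s≤s (≤-trans p≤u u≤n))) (interval-below {suc u} {r} (s≤s p≤u))) (sym (shape-two p≤u))
  ... | inj₂ (inj₁ (u<p , p≤n)) = trans (cong₂ _∸_ (highest-below (s≤s p≤n)) (interval-in {suc u} {r} u<p p≤r)) (sym (shape-one u<p p≤n))
  ... | inj₂ (inj₂ n<p) = trans (cong₂ _∸_ (subst (λ z → highestV z ≡ 1) (sym p≡r) highest-last) (interval-in {suc u} {r} u<p p≤r))
                                (sym (shape-zero u<p n<p))
    where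
    p≡r : p ≡ r
    p≡r = ≤-antisym p≤r n<p
    u<p : u < p
    u<p = ≤-<-trans u≤n n<p

  rootB-below : ∀ {i j p} → p < r → p < i → i ≤ j → rootBV i j p ≡ 0
  rootB-below {i} {j} {p} h1 h2 h3 rewrite ≡ᵇ-false {p} {r} (<⇒≢ h1) | ≤ᵇ-false {j} {p} (<-≤-trans h2 h3) | ≤ᵇ-false {i} {p} h2 = refl
  rootB-middle : ∀ {i v p} → p < r → i ≤ p → p ≤ v → rootBV i (suc v) p ≡ 1
  rootB-middle {i} {v} {p} h1 h2 h3 rewrite ≡ᵇ-false {p} {r} (<⇒≢ h1) | ≤ᵇ-false {suc v} {p} (s≤s h3) | ≤ᵇ-true {i} {p} h2 | ≤ᵇ-true {p} {v} h3 = refl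
  rootB-above : ∀ {i j p} → p < r → j ≤ p → rootBV i j p ≡ 2
  rootB-above {i} {j} {p} h1 h2 rewrite ≡ᵇ-false {p} {r} (<⇒≢ h1) | ≤ᵇ-true {j} {p} h2 | ≤ᵇ-true {p} {n} (≤-pred h1) = refl
  rootC-below : ∀ {i p} → p < r → p < i → rootCV i p ≡ 0
  rootC-below {i} {p} h1 h2 rewrite ≡ᵇ-false {p} {r} (<⇒≢ h1) | ≤ᵇ-false {i} {p} h2 = refl
  rootC-above : ∀ {i p} → p < r → i ≤ p → rootCV i p ≡ 2
  rootC-above {i} {p} h1 h2 rewrite ≡ᵇ-false {p} {r} (<⇒≢ h1) | ≤ᵇ-true {i} {p} h2 | ≤ᵇ-true {p} {n} (≤-pred h1) = refl

  last-or-below : ∀ p → p ≤ r → (p ≡ r) ⊎ (p ≤ n)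
  last-or-below p h with m≤n⇒m<n∨m≡n h
  ... | inj₁ p<r = inj₂ (≤-pred p<r)
  ... | inj₂ p≡r = inj₁ p≡r

  highest∸rootB : ∀ i j → 1 ≤ i → i < j → j ≤ n → (highestV ∸V rootBV i j) ≈ shape (i ∸ 1) (j ∸ 1)
  highest∸rootB (suc u) (suc v) _ (s≤s u<v) v<n p _ p≤r with last-or-below p p≤r
  ... | inj₁ refl = trans (cong₂ _∸_ highest-last (rootB-last (suc u) (suc v)))
                          (sym (shape-zero (s≤s (≤-trans (<⇒≤ u<v) (<⇒≤ v<n))) (s≤s (<⇒≤ v<n))))
  ... | inj₂ p≤n with trichotomy p u v (<⇒≤ u<v)
  ...   | inj₁ p≤u = trans (cong₂ _∸_ (highest-below (s≤s p≤n)) (rootB-below (s≤s p≤n) (s≤s p≤u) (<⇒≤ (s≤s u<v)))) (sym (shape-two p≤u))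
  ...   | inj₂ (inj₁ (u<p , p≤v)) = trans (cong₂ _∸_ (highest-below (s≤s p≤n)) (rootB-middle (s≤s p≤n) u<p p≤v)) (sym (shape-one u<p p≤v))
  ...   | inj₂ (inj₂ v<p) = trans (cong₂ _∸_ (highest-below (s≤s p≤n)) (rootB-above {suc u} (s≤s p≤n) v<p)) (sym (shape-zero (<-trans u<v v<p) v<p))

  highest∸rootC : ∀ i → 1 ≤ i → i ≤ n → (highestV ∸V rootCV i) ≈ shape (i ∸ 1) (i ∸ 1)
  highest∸rootC (suc u) _ u<n p _ p≤r with last-or-below p p≤r
  ... | inj₁ refl = trans (cong₂ _∸_ highest-last (rootC-last (suc u))) (sym (shape-zero (s≤s (<⇒≤ u<n)) (s≤s (<⇒≤ u<n))))
  ... | inj₂ p≤n with p ≤? u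
  ...   | yes p≤u = trans (cong₂ _∸_ (highest-below (s≤s p≤n)) (rootC-below {suc u} (s≤s p≤n) (s≤s p≤u))) (sym (shape-two p≤u))
  ...   | no p≰u = trans (cong₂ _∸_ (highest-below (s≤s p≤n)) (rootC-above {suc u} (s≤s p≤n) (≰⇒> p≰u))) (sym (shape-zero (≰⇒> p≰u) (≰⇒> p≰u)))

  interval-fits-shape : ∀ i u v → (interval i v) ≤V (shape u v) ≡ true
  interval-fits-shape i u v = ≤V-intro _ _ (λ p _ _ → lem p)
    where
    lem : ∀ p → interval i v p ≤ shape u v p
    lem p with p ≤? v
    ... | yes h = ≤-trans (interval-≤1 i v p) (shape-≥1 h)
    ... | no h = subst (_≤ shape u v p) (sym (interval-above {i} {v} {p} (≰⇒> h))) z≤n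

  interval-misfits-shape : ∀ i j u v → u ≤ v → v < j → i ≤ j → 1 ≤ j → j ≤ r → (interval i j) ≤V (shape u v) ≡ false
  interval-misfits-shape i j u v u≤v v<j i≤j 1≤j j≤r =
    ≤V-refute (interval i j) (shape u v) j 1≤j j≤r (subst (_< interval i j j) (sym (shape-zero (≤-<-trans u≤v v<j) v<j)) (interval-at-end i≤j))

  second-interval-fits : ∀ i i' a → (interval i' a) ≤V (shape a a ∸V interval i a) ≡ true
  second-interval-fits i i' a = ≤V-intro _ _ (λ p _ _ → fits p)
    where
    fits : ∀ p → interval i' a p ≤ shape a a p ∸ interval i a p
    fits p with p ≤? a
    ... | yes p≤a = ≤-trans (interval-≤1 i' a p) (subst (1 ≤_) (sym (cong (_∸ interval i a p) (shape-two p≤a))) (∸-monoʳ-≤ 2 (interval-≤1 i a p)))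
    ... | no p≰a = subst (_≤ shape a a p ∸ interval i a p) (sym (interval-above {i'} {a} {p} (≰⇒> p≰a))) z≤n

  second-interval-misfits : ∀ i i' j' a → a < j' → i' ≤ j' → 1 ≤ j' → j' ≤ r → (interval i' j') ≤V (shape a a ∸V interval i a) ≡ false
  second-interval-misfits i i' j' a a<j' i'≤j' 1≤j' j'≤r = ≤V-refute (interval i' j') (shape a a ∸V interval i a) j' 1≤j' j'≤r
    (subst (_< interval i' j' j') (sym (cong₂ _∸_ (shape-zero a<j' a<j') (interval-above {i} {a} a<j'))) (interval-at-end i'≤j'))

  r≥1 : 1 ≤ r
  r≥1 = s≤s z≤n

  toVector-mkRoot-last : ∀ (f : ℕ → ℕ) → toVector (mkRoot r f) r ≡ f r
  toVector-mkRoot-last f = toVector-mkRoot r f r r≥1 ≤-refl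

  -- Roots of families B and C have α_r-coefficient 1, so they are never
  -- interval roots.
  not-interval-B : ∀ {P : Vector → Set} i j → (toVector (rootB r i j) r ≡ᵇ 0) ≡ true → P (toVector (rootB r i j))
  not-interval-B i j e = ⊥-elim (0≢1+n (sym (trans (sym (trans (toVector-mkRoot-last _) (rootB-last i j))) (≡ᵇ-sound e))))

  not-interval-C : ∀ {P : Vector → Set} i → (toVector (rootC r i) r ≡ᵇ 0) ≡ true → P (toVector (rootC r i))
  not-interval-C i e = ⊥-elim (0≢1+n (sym (trans (sym (trans (toVector-mkRoot-last _) (rootC-last i))) (≡ᵇ-sound e))))

  intervalRoots-≤1 : ∀ s → All (λ x → x s ≤ 1) intervalRoots
  intervalRoots-≤1 s = All-bfilter _ (map toVector roots) (all-root-vectors _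
    (λ i j _ _ _ _ _ → coeff-map-≤1 _ (λ q → interval-≤1 i j q) (range1 r) (s ∸ 1))
    (not-interval-B {λ x → x s ≤ 1}) (not-interval-C {λ x → x s ≤ 1}))

  intervalRoots-disjoint : AllDisjoint (λ _ → false) (shape 0 0) intervalRoots
  intervalRoots-disjoint = All-bfilter _ (map toVector roots) (all-root-vectors _
    (λ i j 1≤i i≤r i≤j _ _ _ → i , 1≤i , i≤r , shape-zero 1≤i 1≤i ,
       (λ e → 0≢1+n (sym (trans (sym (trans (toVector-mkRoot r _ i 1≤i i≤r) (interval-in {i} {j} {i} ≤-refl i≤j))) e))))
    (not-interval-B {NoPart}) (not-interval-C {NoPart}))
    where
    NoPart : Vector → Set
    NoPart x = false ≡ false → Disjoint x (shape 0 0)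

  module IntervalsEndingAt (τ : Vector) (s : ℕ) (1≤s : 1 ≤ s) (s≤n : s ≤ n)
         (Φ : Vector → ℕ) (Φ-cong : Respects≈ Φ)
         (fit : ∀ i → 1 ≤ i → i ≤ s → interval i s ≤V τ ≡ true)
         (misfit : ∀ i j → s < j → j ≤ r → i ≤ j → interval i j ≤V τ ≡ false) where

    weight : Vector → ℕ
    weight y = if y s ≡ᵇ 1 then (if y ≤V τ then Φ y else 0) else 0

    rootWeight : Vector → ℕ
    rootWeight y = if y r ≡ᵇ 0 then weight y else 0

    s≤r : s ≤ r
    s≤r = ≤-trans s≤n (n≤1+n n)

    rootWeight-cong : Respects≈ rootWeight
    rootWeight-cong {y} {y'} e = cong₂ (λ u v → if u ≡ᵇ 0 then v else 0) (e r r≥1 ≤-refl)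
      (cong₂ (λ u v → if u ≡ᵇ 1 then v else 0) (e s 1≤s s≤r) (cong₂ (λ b z → if b then z else 0) (≤V-cong {y} {y'} {τ} {τ} e ≈-refl) (Φ-cong e)))

    weight-reaches-r : ∀ y → y r ≡ 1 → rootWeight y ≡ 0
    weight-reaches-r y e = cong (λ u → if u ≡ᵇ 0 then weight y else 0) e

    weight-misses-s : ∀ y → y r ≡ 0 → y s ≡ 0 → rootWeight y ≡ 0
    weight-misses-s y e1 e2 = trans (cong (λ u → if u ≡ᵇ 0 then weight y else 0) e1)
                                    (cong (λ u → if u ≡ᵇ 1 then (if y ≤V τ then Φ y else 0) else 0) e2)

    weight-when : ∀ y → y r ≡ 0 → y s ≡ 1 → rootWeight y ≡ (if y ≤V τ then Φ y else 0)
    weight-when y e1 e2 = trans (cong (λ u → if u ≡ᵇ 0 then weight y else 0) e1)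
                                (cong (λ u → if u ≡ᵇ 1 then (if y ≤V τ then Φ y else 0) else 0) e2)

    weight-misfit : ∀ y → y r ≡ 0 → y s ≡ 1 → y ≤V τ ≡ false → rootWeight y ≡ 0
    weight-misfit y e1 e2 e3 = trans (weight-when y e1 e2) (cong (λ b → if b then Φ y else 0) e3)

    weight-fit : ∀ y → y r ≡ 0 → y s ≡ 1 → y ≤V τ ≡ true → rootWeight y ≡ Φ y
    weight-fit y e1 e2 e3 = trans (weight-when y e1 e2) (cong (λ b → if b then Φ y else 0) e3)

    interval-weight : ∀ i j → 1 ≤ i → i ≤ r → 1 ≤ j → j ≤ r →
      (if i ≤ᵇ j then rootWeight (interval i j) else 0) ≡ (if j ≡ᵇ s then (if i ≤ᵇ s then Φ (interval i s) else 0) else 0)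
    interval-weight i j 1≤i i≤r 1≤j j≤r with j ℕ.≟ s
    ... | yes refl with i ≤? j
    ...   | yes i≤j = trans (if-true (≤ᵇ-true i≤j))
                           (trans (weight-fit (interval i j) (interval-above {i} {j} {r} (s≤s s≤n)) (interval-in {i} {j} {j} i≤j ≤-refl) (fit i 1≤i i≤j))
                                  (sym (trans (if-true (≡ᵇ-true {j} refl)) (if-true (≤ᵇ-true i≤j)))))
    ...   | no i≰j = trans (if-false (≤ᵇ-false (≰⇒> i≰j))) (sym (trans (if-true (≡ᵇ-true {j} refl)) (if-false (≤ᵇ-false (≰⇒> i≰j)))))
    interval-weight i j 1≤i i≤r 1≤j j≤r | no j≢s with i ≤? j
    ...   | no i≰j = trans (if-false (≤ᵇ-false (≰⇒> i≰j))) (sym (if-false (≡ᵇ-false j≢s)))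
    ...   | yes i≤j = trans (if-true (≤ᵇ-true i≤j)) (trans vanishes (sym (if-false (≡ᵇ-false j≢s))))
      where
      vanishes : rootWeight (interval i j) ≡ 0
      vanishes with last-or-below j j≤r
      ... | inj₁ refl = weight-reaches-r (interval i j) (interval-in {i} {j} {r} i≤r ≤-refl)
      ... | inj₂ j≤n with s ≤? j | i ≤? s
      ...   | yes s≤j | yes i≤s = weight-misfit (interval i j) (interval-above {i} {j} {r} (s≤s j≤n)) (interval-in {i} {j} {s} i≤s s≤j)
                                                (misfit i j (≤∧≢⇒< s≤j (λ e → j≢s (sym e))) j≤r i≤j)
      ...   | yes s≤j | no i≰s = weight-misses-s (interval i j) (interval-above {i} {j} {r} (s≤s j≤n)) (interval-below {i} {j} {s} (≰⇒> i≰s))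
      ...   | no s≰j | _ = weight-misses-s (interval i j) (interval-above {i} {j} {r} (s≤s j≤n)) (interval-above {i} {j} {s} (≰⇒> s≰j))

    sum-over-intervals : sumOver intervalRoots weight ≡ sumTo s (λ i → Φ (interval i s))
    sum-over-intervals = begin
        sumOver intervalRoots weight                     ≡⟨ sumOver-bfilter (λ x → x r ≡ᵇ 0) (map toVector roots) weight ⟩
        sumOver (map toVector roots) rootWeight          ≡⟨ sum-over-roots rootWeight rootWeight-cong ⟩
        _                                                ≡⟨ cong₂ _+_ sumA (cong₂ _+_ sumB sumC) ⟩
        sumTo s (λ i → Φ (interval i s)) + 0             ≡⟨ +-identityʳ _ ⟩
        sumTo s (λ i → Φ (interval i s))                 ∎
      where
      open ≡-Reasoning
      sumA : sumTo r (λ i → sumTo r (λ j → if i ≤ᵇ j then rootWeight (interval i j) else 0)) ≡ sumTo s (λ i → Φ (interval i s))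
      sumA = trans (sumTo-cong r (λ i 1≤i i≤r → trans (sumTo-cong r (λ j 1≤j j≤r → interval-weight i j 1≤i i≤r 1≤j j≤r))
                     (trans (sumTo-single r s _ 1≤s s≤r (λ j _ _ j≢s → if-false (≡ᵇ-false j≢s))) (if-true (≡ᵇ-true {s} refl)))))
             (trans (sumTo-trunc s r _ s≤r (λ i s<i _ → if-false (≤ᵇ-false s<i))) (sumTo-cong s (λ i _ i≤s → if-true (≤ᵇ-true i≤s))))
      sumB : sumTo n (λ i → sumTo n (λ j → if suc i ≤ᵇ j then rootWeight (rootBV i j) else 0)) ≡ 0
      sumB = sumTo-zero n _ (λ i _ _ → sumTo-zero n _ (λ j _ _ →
               trans (cong (λ z → if suc i ≤ᵇ j then z else 0) (weight-reaches-r (rootBV i j) (rootB-last i j))) (if-0 (suc i ≤ᵇ j))))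
      sumC : sumTo n (λ i → rootWeight (rootCV i)) ≡ 0
      sumC = sumTo-zero n _ (λ i _ _ → weight-reaches-r (rootCV i) (rootC-last i))

  -- shapeCount a b k = number of k-multisets of interval roots with sum
  -- shape a (a + b), i.e. a twos followed by b ones.
  shapeCount : ℕ → ℕ → ℕ → ℕ
  shapeCount a b k = count intervalRoots (shape a (a + b)) k

  -- The last non-zero position s = a + b of the shape carries a 1: the unique
  -- part through s is an interval [i, s]; removing it leaves a smaller shape.
  shapeCount-ones : ∀ a b k → a + suc b ≤ n →
    shapeCount a (suc b) (suc k) ≡ sumTo a (λ i → shapeCount (i ∸ 1) (suc (a ∸ i)) k) + sumTo (suc b) (λ b' → shapeCount a (b' ∸ 1) k)
  shapeCount-ones a b k s≤n = begin
      count intervalRoots t (suc k)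
        ≡⟨ count-split-unit intervalRoots (intervalRoots-≤1 s) k t ts ⟩
      sumOver (bfilter atOne intervalRoots) (removeOne (bfilter atZero intervalRoots) t k)
        ≡⟨ sumOver-bfilter atOne intervalRoots _ ⟩
      sumOver intervalRoots (λ x → if atOne x then removeOne (bfilter atZero intervalRoots) t k x else 0)
        ≡⟨ sumOver-cong intervalRoots (λ x → if-cong-then (atOne x) (λ e → cong (λ z → if x ≤V t then z else 0) (sym (unfiltered x e)))) ⟩
      sumOver intervalRoots E.weight
        ≡⟨ E.sum-over-intervals ⟩
      sumTo s (λ i → Φ (interval i s))
        ≡⟨ sumTo-split a (suc b) _ ⟩
      sumTo a (λ i → Φ (interval i s)) + sumTo (suc b) (λ b' → Φ (interval (a + b') s))
        ≡⟨ cong₂ _+_ (sumTo-cong a long) (sumTo-cong (suc b) short) ⟩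
      sumTo a (λ i → shapeCount (i ∸ 1) (suc (a ∸ i)) k) + sumTo (suc b) (λ b' → shapeCount a (b' ∸ 1) k) ∎
    where
    open ≡-Reasoning
    s = a + suc b
    t = shape a s
    1≤s : 1 ≤ s
    1≤s = ≤-trans (s≤s z≤n) (≤-reflexive (sym (+-suc a b)))
    s≤r : s ≤ r
    s≤r = ≤-trans s≤n (n≤1+n n)
    a<s : a < s
    a<s = ≤-trans (s≤s (m≤m+n a b)) (≤-reflexive (sym (+-suc a b)))
    ts : t s ≡ 1
    ts = shape-one a<s ≤-refl
    open SplitAt s 1≤s s≤r
    Φ : Vector → ℕ
    Φ y = count intervalRoots (t ∸V y) k
    Φ-cong : Respects≈ Φ
    Φ-cong {x} {x'} e = count-cong intervalRoots k (∸V-cong {t} {t} {x} {x'} ≈-refl e)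
    module E = IntervalsEndingAt t s 1≤s s≤n Φ Φ-cong (λ i _ _ → interval-fits-shape i a s)
                 (λ i j s<j j≤r i≤j → interval-misfits-shape i j a s (m≤m+n a (suc b)) s<j i≤j (≤-trans (s≤s z≤n) s<j) j≤r)
    -- after removing a part through s, the other parts avoid s anyway
    unfiltered : ∀ x → atOne x ≡ true → count intervalRoots (t ∸V x) k ≡ count (bfilter atZero intervalRoots) (t ∸V x) k
    unfiltered x e = count-bfilter atZero intervalRoots k (t ∸V x) (all-disjoint-at s 1≤s s≤r (t ∸V x) (cong₂ _∸_ ts (≡ᵇ-sound {x s} {1} e)) intervalRoots)
    long : ∀ i → 1 ≤ i → i ≤ a → Φ (interval i s) ≡ shapeCount (i ∸ 1) (suc (a ∸ i)) k
    long i 1≤i i≤a = trans (count-cong intervalRoots k (λ p _ _ → shape∸long-interval i a s 1≤i i≤a a<s p))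
                           (cong (λ v → count intervalRoots (shape (i ∸ 1) v) k) (sym (pred+suc∸ i a 1≤i i≤a)))
    short : ∀ b' → 1 ≤ b' → b' ≤ suc b → Φ (interval (a + b') s) ≡ shapeCount a (b' ∸ 1) k
    short b' 1≤b' b'≤ = trans (count-cong intervalRoots k (λ p _ _ → shape∸short-interval (a + b') a s a<a+b' (+-monoʳ-≤ a b'≤) p))
                             (cong (λ v → count intervalRoots (shape a v) k) (+-∸-assoc a 1≤b'))
      where
      a<a+b' : a < a + b'
      a<a+b' = subst (_≤ a + b') (+-comm a 1) (+-monoʳ-≤ a 1≤b')

  -- When the shape ends with a two at position a, two parts (possibly equal)
  -- pass through a; they are intervals [i, a], [i', a].  Counting unordered
  -- pairs is done by doubling: twice the count is the sum over ordered pairs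
  -- plus the diagonal, i.e. twice the sum over i ≤ i'.
  module EndingInTwo (a k : ℕ) (1≤a : 1 ≤ a) (a≤n : a ≤ n) where
    t = shape a a
    ta : t a ≡ 2
    ta = shape-two {a} {a} {a} ≤-refl
    a≤r : a ≤ r
    a≤r = ≤-trans a≤n (n≤1+n n)
    open SplitAt a 1≤a a≤r
    M = bfilter atOne intervalRoots
    L0 = bfilter atZero intervalRoots

    pairWeight : Vector → Vector → ℕ
    pairWeight = removePair L0 t k

    pairWeight-sym : ∀ x y → pairWeight x y ≡ pairWeight y x
    pairWeight-sym x y = remove-pair-comm (λ w → count L0 w k) (count-cong L0 k) x y t

    W : ℕ → ℕ → ℕ
    W i i' = count intervalRoots ((t ∸V interval i a) ∸V interval i' a) k

    W-sym : ∀ i i' → W i i' ≡ W i' i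
    W-sym i i' = count-cong intervalRoots k (∸V-comm t (interval i a) (interval i' a))

    fitsIn : Vector → Vector → ℕ
    fitsIn w y = removeOne intervalRoots w k y

    fitsIn-cong : ∀ {w w'} → w ≈ w' → ∀ y → fitsIn w y ≡ fitsIn w' y
    fitsIn-cong {w} {w'} e y = cong₂ (λ b z → if b then z else 0) (≤V-cong {y} {y} {w} {w'} ≈-refl e)
                                      (count-cong intervalRoots k (∸V-cong {w} {w'} {y} {y} e ≈-refl))

    -- after removing two parts through a, the others avoid a anyway
    unfiltered : ∀ x y → atOne x ≡ true → atOne y ≡ true → removeOne L0 (t ∸V x) k y ≡ fitsIn (t ∸V x) y
    unfiltered x y ex ey = cong (λ z → if y ≤V (t ∸V x) then z else 0)
      (sym (count-bfilter atZero intervalRoots k ((t ∸V x) ∸V y)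
             (all-disjoint-at a 1≤a a≤r ((t ∸V x) ∸V y) (cong₂ _∸_ (cong₂ _∸_ ta (≡ᵇ-sound {x a} {1} ex)) (≡ᵇ-sound {y a} {1} ey)) intervalRoots)))

    misfit : ∀ i j → a < j → j ≤ r → i ≤ j → interval i j ≤V t ≡ false
    misfit i j a<j j≤r i≤j = interval-misfits-shape i j a a ≤-refl a<j i≤j (≤-trans (s≤s z≤n) a<j) j≤r

    ordered-pairs : sumOver M (λ x → sumOver M (pairWeight x)) ≡ sumTo a (λ i → sumTo a (λ i' → W i i'))
    ordered-pairs = begin
        sumOver M (λ x → sumOver M (pairWeight x))
          ≡⟨ sumOver-bfilter atOne intervalRoots _ ⟩
        sumOver intervalRoots (λ x → if atOne x then sumOver M (pairWeight x) else 0)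
          ≡⟨ sumOver-cong intervalRoots (λ x → if-cong-then (atOne x) (inner x)) ⟩
        sumOver intervalRoots (λ x → if atOne x then (if x ≤V t then Inner x else 0) else 0)
          ≡⟨ IntervalsEndingAt.sum-over-intervals t a 1≤a a≤n Inner Inner-cong (λ i _ _ → interval-fits-shape i a a) misfit ⟩
        sumTo a (λ i → Inner (interval i a))
          ≡⟨ sumTo-cong a (λ i _ _ → second-sum i) ⟩
        sumTo a (λ i → sumTo a (λ i' → W i i')) ∎
      where
      open ≡-Reasoning
      Inner : Vector → ℕ
      Inner x = sumOver intervalRoots (λ y → if atOne y then fitsIn (t ∸V x) y else 0)
      Inner-cong : Respects≈ Inner
      Inner-cong {x} {x'} e = sumOver-cong intervalRoots (λ y → cong (λ z → if atOne y then z else 0) (fitsIn-cong (∸V-cong {t} {t} {x} {x'} ≈-refl e) y))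
      inner : ∀ x → atOne x ≡ true → sumOver M (pairWeight x) ≡ (if x ≤V t then Inner x else 0)
      inner x ex = trans (sumOver-bfilter atOne intervalRoots (pairWeight x))
                         (trans (sumOver-cong intervalRoots (λ y → trans (if-swap-then (atOne y) (x ≤V t))
                                   (cong (λ z → if x ≤V t then z else 0) (if-cong-then (atOne y) (λ ey → unfiltered x y ex ey)))))
                                (sym (sumOver-if intervalRoots (x ≤V t) _)))
      second-sum : ∀ i → Inner (interval i a) ≡ sumTo a (λ i' → W i i')
      second-sum i = IntervalsEndingAt.sum-over-intervals (t ∸V interval i a) a 1≤a a≤n (λ y → count intervalRoots ((t ∸V interval i a) ∸V y) k)
                       (λ {x} {x'} e → count-cong intervalRoots k (∸V-cong {t ∸V interval i a} {t ∸V interval i a} {x} {x'} ≈-refl e))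
                       (λ i' _ _ → second-interval-fits i i' a)
                       (λ i' j' a<j' j'≤r i'≤j' → second-interval-misfits i i' j' a a<j' i'≤j' (≤-trans (s≤s z≤n) a<j') j'≤r)

    diagonal : sumOver M (λ x → pairWeight x x) ≡ sumTo a (λ i → W i i)
    diagonal = begin
        sumOver M (λ x → pairWeight x x)
          ≡⟨ sumOver-bfilter atOne intervalRoots _ ⟩
        sumOver intervalRoots (λ x → if atOne x then pairWeight x x else 0)
          ≡⟨ sumOver-cong intervalRoots (λ x → if-cong-then (atOne x) (λ ex → cong (λ z → if x ≤V t then z else 0) (unfiltered x x ex ex))) ⟩
        sumOver intervalRoots (λ x → if atOne x then (if x ≤V t then Twice x else 0) else 0)
          ≡⟨ IntervalsEndingAt.sum-over-intervals t a 1≤a a≤n Twice Twice-cong (λ i _ _ → interval-fits-shape i a a) misfit ⟩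
        sumTo a (λ i → Twice (interval i a))
          ≡⟨ sumTo-cong a (λ i _ _ → if-true (second-interval-fits i i a)) ⟩
        sumTo a (λ i → W i i) ∎
      where
      open ≡-Reasoning
      Twice : Vector → ℕ
      Twice x = fitsIn (t ∸V x) x
      Twice-cong : Respects≈ Twice
      Twice-cong {x} {x'} e = cong₂ (λ b z → if b then z else 0) (≤V-cong e (∸V-cong {t} {t} {x} {x'} ≈-refl e))
                                    (count-cong intervalRoots k (∸V-cong (∸V-cong {t} {t} {x} {x'} ≈-refl e) e))

    doubled : count intervalRoots t (suc (suc k)) + count intervalRoots t (suc (suc k))
              ≡ sumTo a (λ i' → sumTo i' (λ i → W i i')) + sumTo a (λ i' → sumTo i' (λ i → W i i'))
    doubled = begin
        count intervalRoots t (suc (suc k)) + count intervalRoots t (suc (suc k))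
          ≡⟨ cong₂ _+_ split split ⟩
        pairSum M pairWeight + pairSum M pairWeight
          ≡⟨ pairSum-double pairWeight pairWeight-sym M ⟩
        sumOver M (λ x → sumOver M (pairWeight x)) + sumOver M (λ x → pairWeight x x)
          ≡⟨ cong₂ _+_ ordered-pairs diagonal ⟩
        sumTo a (λ i → sumTo a (λ i' → W i i')) + sumTo a (λ i → W i i)
          ≡⟨ sumTo-symmetric-square a W W-sym ⟩
        _ ∎
      where
      open ≡-Reasoning
      split = count-split-two intervalRoots (intervalRoots-≤1 a) k t ta

  shapeCount-twos : ∀ a k → 1 ≤ a → a ≤ n → shapeCount a 0 (suc (suc k)) ≡ sumTo a (λ i' → sumTo i' (λ i → shapeCount (i ∸ 1) (i' ∸ i) k))
  shapeCount-twos a k 1≤a a≤n = begin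
      shapeCount a 0 (suc (suc k))                         ≡⟨ cong (λ v → count intervalRoots (shape a v) (suc (suc k))) (+-identityʳ a) ⟩
      count intervalRoots (shape a a) (suc (suc k))        ≡⟨ halve _ _ doubled ⟩
      sumTo a (λ i' → sumTo i' (λ i → W i i'))             ≡⟨ sumTo-cong a (λ i' _ i'≤a → sumTo-cong i' (λ i 1≤i i≤i' → remainder i i' 1≤i i≤i' i'≤a)) ⟩
      sumTo a (λ i' → sumTo i' (λ i → shapeCount (i ∸ 1) (i' ∸ i) k)) ∎
    where
    open ≡-Reasoning
    open EndingInTwo a k 1≤a a≤n
    remainder : ∀ i i' → 1 ≤ i → i ≤ i' → i' ≤ a → W i i' ≡ shapeCount (i ∸ 1) (i' ∸ i) k
    remainder i i' 1≤i i≤i' i'≤a = trans (count-cong intervalRoots k (λ p _ _ → shape∸two-intervals i i' a 1≤i i≤i' i'≤a p))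
                                         (cong (λ v → count intervalRoots (shape (i ∸ 1) v) k) (sym (pred+∸ i i' 1≤i i≤i')))

  shapeCount-nothing : ∀ a b → 1 ≤ a + b → shapeCount a b 0 ≡ 0
  shapeCount-nothing a b h = zeroIndicator-0 {shape a (a + b)} 1 ≤-refl r≥1 (m<n⇒n≢0 (shape-≥1 {a} {a + b} {1} h))

  shapeCount-single : ∀ a → 1 ≤ a → a ≤ n → shapeCount a 0 1 ≡ 0
  shapeCount-single a 1≤a a≤n = trans (cong (λ v → count intervalRoots (shape a v) 1) (+-identityʳ a))
    (SplitAt.count-one-at-two a 1≤a (≤-trans a≤n (n≤1+n n)) intervalRoots (intervalRoots-≤1 a) (shape a a) (shape-two {a} {a} {a} ≤-refl))

  shapeCount-empty-empty : shapeCount 0 0 0 ≡ 1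
  shapeCount-empty-empty = cong (λ b → if b then 1 else 0) (allUpTo-intro r _ (λ p 1≤p _ → ≡ᵇ-true (shape-zero {0} {0} {p} 1≤p 1≤p)))

  shapeCount-empty-nonempty : ∀ k → shapeCount 0 0 (suc k) ≡ 0
  shapeCount-empty-nonempty k = trans (count-bfilter (λ _ → false) intervalRoots (suc k) (shape 0 0) intervalRoots-disjoint)
                                      (cong (λ l → count l (shape 0 0) (suc k)) (bfilter-none intervalRoots))
    where
    bfilter-none : ∀ (xs : List Vector) → bfilter (λ _ → false) xs ≡ []
    bfilter-none [] = refl
    bfilter-none (x ∷ xs) = bfilter-none xs

  -- Splitting a partition of the highest root at its unique part x with
  -- α_r-coefficient 1:  a_{k+1}(C_r) = Σ_{1 ≤ i ≤ j ≤ r} F(i-1, j-i, k).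
  -- (x = [i, r] gives j = r; x = B(i, j) gives i < j < r; x = C(i) gives i = j < r.)
  numPartitions-by-shapes : ∀ k → numPartitions r (suc k) ≡ sumTo r (λ j → sumTo j (λ i → shapeCount (i ∸ 1) (j ∸ i) k))
  numPartitions-by-shapes k = begin
      numPartitions r (suc k)
        ≡⟨ FromLists.numPartitions≡count r (suc k) length-roots (length-mkRoot r _) ⟩
      count (map toVector roots) highestVec (suc k)
        ≡⟨ Last.count-split-unit (map toVector roots) roots-≤1 k highestVec highestVec-last ⟩
      sumOver (bfilter Last.atOne (map toVector roots)) (Last.removeOne intervalRoots highestVec k)
        ≡⟨ sumOver-bfilter Last.atOne (map toVector roots) _ ⟩
      sumOver (map toVector roots) weight
        ≡⟨ sum-over-roots weight weight-cong ⟩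
      _ ≡⟨ cong₂ _+_ sumA (cong₂ _+_ sumB sumC) ⟩
      sumTo r lastColumn + (sumTo n (λ i → sumTo n (λ j → if suc i ≤ᵇ j then G j i else 0)) + sumTo n (λ i → G i i))
        ≡⟨ cong (sumTo r lastColumn +_) (sumTo-triangle n G) ⟩
      sumTo r lastColumn + sumTo n (λ j → sumTo j (G j))
        ≡⟨ +-comm (sumTo r lastColumn) _ ⟩
      sumTo r (λ j → sumTo j (λ i → shapeCount (i ∸ 1) (j ∸ i) k)) ∎
    where
    open ≡-Reasoning
    module Last = SplitAt r r≥1 ≤-refl
    roots-≤1 : All (λ x → x r ≤ 1) (map toVector roots)
    roots-≤1 = all-root-vectors _ (λ i j _ _ _ _ → coeff-map-≤1 _ (interval-≤1 i j) (range1 r) (r ∸ 1))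
                 (λ i j → ≤-reflexive (trans (toVector-mkRoot-last _) (rootB-last i j)))
                 (λ i → ≤-reflexive (trans (toVector-mkRoot-last _) (rootC-last i)))
    highestVec-last : highestVec r ≡ 1
    highestVec-last = trans (highestVec≈ r r≥1 ≤-refl) highest-last
    weight : Vector → ℕ
    weight x = if x r ≡ᵇ 1 then Last.removeOne intervalRoots highestVec k x else 0
    weight-cong : Respects≈ weight
    weight-cong {x} {x'} e = cong₂ (λ u v → if u ≡ᵇ 1 then v else 0) (e r r≥1 ≤-refl)
      (cong₂ (λ b z → if b then z else 0) (≤V-cong {x} {x'} {highestVec} {highestVec} e ≈-refl)
                                        (count-cong intervalRoots k (∸V-cong {highestVec} {highestVec} {x} {x'} ≈-refl e)))
    lastColumn : ℕ → ℕ
    lastColumn i = shapeCount (i ∸ 1) (r ∸ i) k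
    G : ℕ → ℕ → ℕ
    G j i = shapeCount (i ∸ 1) (j ∸ i) k
    weight-shape : ∀ x u v → x r ≡ 1 → x ≤V highestV ≡ true → (highestV ∸V x) ≈ shape u v → weight x ≡ count intervalRoots (shape u v) k
    weight-shape x u v e1 e2 e3 = trans (cong (λ w → if w ≡ᵇ 1 then Last.removeOne intervalRoots highestVec k x else 0) e1)
      (trans (cong (λ b → if b then count intervalRoots (highestVec ∸V x) k else 0) (trans (≤V-cong {x} {x} {highestVec} {highestV} ≈-refl highestVec≈) e2))
             (count-cong intervalRoots k (λ p a b → trans (cong (_∸ x p) (highestVec≈ p a b)) (e3 p a b))))
    sumA : sumTo r (λ i → sumTo r (λ j → if i ≤ᵇ j then weight (interval i j) else 0)) ≡ sumTo r lastColumn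
    sumA = sumTo-cong r (λ i 1≤i i≤r → trans (sumTo-cong r (λ j _ j≤r → only-last i j 1≤i i≤r j≤r))
             (trans (sumTo-single r r _ r≥1 ≤-refl (λ j _ _ j≢r → if-false (≡ᵇ-false j≢r))) (if-true (≡ᵇ-true {r} refl))))
      where
      only-last : ∀ i j → 1 ≤ i → i ≤ r → j ≤ r → (if i ≤ᵇ j then weight (interval i j) else 0) ≡ (if j ≡ᵇ r then lastColumn i else 0)
      only-last i j 1≤i i≤r j≤r with last-or-below j j≤r
      ... | inj₁ refl = trans (if-true (≤ᵇ-true i≤r))
                          (trans (weight-shape (interval i j) (i ∸ 1) n (interval-in {i} {j} {r} i≤r ≤-refl) (interval-fits-highest i) (highest∸interval i 1≤i i≤r))
                          (trans (cong (λ v → count intervalRoots (shape (i ∸ 1) v) k) (sym (pred+∸ i r 1≤i i≤r))) (sym (if-true (≡ᵇ-true {r} refl)))))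
      ... | inj₂ j≤n = trans (cong (λ z → if i ≤ᵇ j then z else 0)
                               (cong (λ u → if u ≡ᵇ 1 then Last.removeOne intervalRoots highestVec k (interval i j) else 0) (interval-above {i} {j} {r} (s≤s j≤n))))
                             (trans (if-0 (i ≤ᵇ j)) (sym (if-false (≡ᵇ-false (<⇒≢ (s≤s j≤n))))))
    sumB : sumTo n (λ i → sumTo n (λ j → if suc i ≤ᵇ j then weight (rootBV i j) else 0)) ≡ sumTo n (λ i → sumTo n (λ j → if suc i ≤ᵇ j then G j i else 0))
    sumB = sumTo-cong n (λ i 1≤i _ → sumTo-cong n (λ j _ j≤n → if-cong-then (suc i ≤ᵇ j) (λ e →
             let i<j = ≤ᵇ-sound {suc i} {j} e in
             trans (weight-shape (rootBV i j) (i ∸ 1) (j ∸ 1) (rootB-last i j) (rootB-fits-highest i j) (highest∸rootB i j 1≤i i<j j≤n))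
                   (cong (λ v → count intervalRoots (shape (i ∸ 1) v) k) (sym (pred+∸ i j 1≤i (<⇒≤ i<j)))))))
    sumC : sumTo n (λ i → weight (rootCV i)) ≡ sumTo n (λ i → G i i)
    sumC = sumTo-cong n (λ i 1≤i i≤n → trans (weight-shape (rootCV i) (i ∸ 1) (i ∸ 1) (rootC-last i) (rootC-fits-highest i) (highest∸rootC i 1≤i i≤n))
             (cong (λ v → count intervalRoots (shape (i ∸ 1) v) k) (sym (trans (cong ((i ∸ 1) +_) (n∸n≡0 i)) (+-identityʳ (i ∸ 1))))))

-- The recursion for shape counts, taken as a definition independent of r

-- F a b k : the number of k-multisets of intervals with sum the shape of
-- a twos followed by b ones (see shapeCount-ones and shapeCount-twos).
F : ℕ → ℕ → ℕ → ℕ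
F a (suc b) (suc k) = sumTo a (λ i → F (i ∸ 1) (suc (a ∸ i)) k) + sumTo (suc b) (λ b' → F a (b' ∸ 1) k)
F zero zero zero = 1
F zero (suc b) zero = 0
F (suc a) b zero = 0
F zero zero (suc k) = 0
F (suc a) zero (suc zero) = 0
F (suc a) zero (suc (suc k)) = sumTo (suc a) (λ i' → sumTo i' (λ i → F (i ∸ 1) (i' ∸ i) k))

-- T r k = a_{k+1}(C_r), by numPartitions-by-shapes
T : ℕ → ℕ → ℕ
T r k = sumTo r (λ j → sumTo j (λ i → F (i ∸ 1) (j ∸ i) k))

module _ (n : ℕ) where
  open RootsC n

  shapeCount≡F : ∀ k a b → a + b ≤ n → shapeCount a b k ≡ F a b k
  shapeCount≡F zero zero zero h = shapeCount-empty-empty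
  shapeCount≡F zero zero (suc b) h = shapeCount-nothing 0 (suc b) (s≤s z≤n)
  shapeCount≡F zero (suc a) zero h = shapeCount-nothing (suc a) zero (s≤s z≤n)
  shapeCount≡F zero (suc a) (suc b) h = shapeCount-nothing (suc a) (suc b) (s≤s z≤n)
  shapeCount≡F (suc k) a (suc b) h = trans (shapeCount-ones a b k h) (cong₂ _+_
       (sumTo-cong a (λ i 1≤i i≤a → shapeCount≡F k (i ∸ 1) (suc (a ∸ i)) (≤-trans (≤-reflexive (pred+suc∸ i a 1≤i i≤a)) (≤-trans (m≤m+n a (suc b)) h))))
       (sumTo-cong (suc b) (λ b' _ b'≤ → shapeCount≡F k a (b' ∸ 1) (≤-trans (+-monoʳ-≤ a (≤-trans (m∸n≤m b' 1) b'≤)) h))))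
  shapeCount≡F (suc k) zero zero h = shapeCount-empty-nonempty k
  shapeCount≡F (suc zero) (suc a) zero h = shapeCount-single (suc a) (s≤s z≤n) a+1≤n
    where
    a+1≤n : suc a ≤ n
    a+1≤n = subst (_≤ n) (+-identityʳ (suc a)) h
  shapeCount≡F (suc (suc k)) (suc a) zero h = trans (shapeCount-twos (suc a) k (s≤s z≤n) a+1≤n)
    (sumTo-cong (suc a) (λ i' _ i'≤ → sumTo-cong i' (λ i 1≤i i≤i' →
       shapeCount≡F k (i ∸ 1) (i' ∸ i) (≤-trans (≤-reflexive (pred+∸ i i' 1≤i i≤i')) (≤-trans (m∸n≤m i' 1) (≤-trans i'≤ a+1≤n))))))
    where
    a+1≤n : suc a ≤ n
    a+1≤n = subst (_≤ n) (+-identityʳ (suc a)) h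

  numPartitions≡T : ∀ k → numPartitions (suc n) (suc k) ≡ T (suc n) k
  numPartitions≡T k = trans (numPartitions-by-shapes k) (sumTo-cong (suc n) (λ j _ j≤r → sumTo-cong j (λ i 1≤i i≤j →
            shapeCount≡F k (i ∸ 1) (j ∸ i) (≤-trans (≤-reflexive (pred+∸ i j 1≤i i≤j)) (∸-monoˡ-≤ 1 j≤r)))))

-- Identities between coefficient sequences (k ↦ value at q^k)

-- multiplication by q
shift : (ℕ → ℕ) → ℕ → ℕ
shift X zero = 0
shift X (suc k) = X k

unit : ℕ → ℕ
unit zero = 1
unit (suc k) = 0

shift-+ : ∀ X Y k → shift (λ j → X j + Y j) k ≡ shift X k + shift Y k
shift-+ X Y zero = refl
shift-+ X Y (suc k) = refl

shift-cong : ∀ {X Y} → (∀ j → X j ≡ Y j) → ∀ k → shift X k ≡ shift Y k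
shift-cong h zero = refl
shift-cong h (suc k) = h k

shift³ : (ℕ → ℕ) → ℕ → ℕ
shift³ X = shift (shift (shift X))

shift³-+ : ∀ X Y k → shift³ (λ j → X j + Y j) k ≡ shift³ X k + shift³ Y k
shift³-+ X Y k = trans (shift-cong (shift-cong (shift-+ X Y)) k) (trans (shift-cong (shift-+ (shift X) (shift Y)) k) (shift-+ (shift (shift X)) (shift (shift Y)) k))

sumTo-shift : ∀ m (Y : ℕ → ℕ → ℕ) k → sumTo m (λ i → shift (Y i) k) ≡ shift (λ j → sumTo m (λ i → Y i j)) k
sumTo-shift m Y zero = sumTo-zero m _ (λ _ _ _ → refl)
sumTo-shift m Y (suc k) = refl

byOnePlusQ² : (ℕ → ℕ) → ℕ → ℕ
byOnePlusQ² X k = X k + shift X k + shift X k + shift (shift X) k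

byOnePlusQ²-cong : ∀ {X Y} → (∀ j → X j ≡ Y j) → ∀ k → byOnePlusQ² X k ≡ byOnePlusQ² Y k
byOnePlusQ²-cong h k = cong₂ _+_ (cong₂ _+_ (cong₂ _+_ (h k) (shift-cong h k)) (shift-cong h k)) (shift-cong (shift-cong h) k)

byOnePlusQ²-+ : ∀ X Y k → byOnePlusQ² (λ j → X j + Y j) k ≡ byOnePlusQ² X k + byOnePlusQ² Y k
byOnePlusQ²-+ X Y k = begin
    (X k + Y k) + shift (λ j → X j + Y j) k + shift (λ j → X j + Y j) k + shift (shift (λ j → X j + Y j)) k
      ≡⟨ cong₂ _+_ (cong₂ _+_ (cong ((X k + Y k) +_) (shift-+ X Y k)) (shift-+ X Y k))
                   (trans (shift-cong (shift-+ X Y) k) (shift-+ (shift X) (shift Y) k)) ⟩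
    (X k + Y k) + (shift X k + shift Y k) + (shift X k + shift Y k) + (shift (shift X) k + shift (shift Y) k)
      ≡⟨ regroup (X k) (Y k) (shift X k) (shift Y k) (shift (shift X) k) (shift (shift Y) k) ⟩
    byOnePlusQ² X k + byOnePlusQ² Y k ∎
  where
  open ≡-Reasoning
  regroup : ∀ a b c d e f → (a + b) + (c + d) + (c + d) + (e + f) ≡ (a + c + c + e) + (b + d + d + f)
  regroup = solve-∀

-- U m = Σ_{a + b = m} F(a, b): all shapes ending at position m (indexed by
-- i = a + 1), so that  T (m + 1) = T m + U m.
U : ℕ → ℕ → ℕ
U m k = sumTo (suc m) (λ i → F (i ∸ 1) (suc m ∸ i) k)

-- D a: the part of U a made of shapes that end with a one (b ≥ 1)
D : ℕ → ℕ → ℕ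
D a k = sumTo a (λ i → F (i ∸ 1) (suc (a ∸ i)) k)

F-nothing : ∀ a b → F a (suc b) 0 ≡ 0
F-nothing zero b = refl
F-nothing (suc a) b = refl

F-ones-step : ∀ a b k → F a (suc (suc b)) k ≡ F a (suc b) k + shift (F a (suc b)) k
F-ones-step a b zero = trans (F-nothing a (suc b)) (sym (cong (_+ 0) (F-nothing a b)))
F-ones-step a b (suc k) = sym (+-assoc (D a k) _ _)

U-split : ∀ a k → U a k ≡ D a k + F a 0 k
U-split a k = cong₂ _+_ (sumTo-cong a (λ i _ i≤a → cong (λ v → F (i ∸ 1) v k) (+-∸-assoc 1 i≤a))) (cong (λ v → F a v k) (n∸n≡0 a))

F-one : ∀ a k → F a 1 k ≡ shift (U a) k
F-one a zero = F-nothing a 0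
F-one a (suc k) = sym (U-split a k)

F-twos : ∀ a k → F (suc a) 0 k ≡ shift (shift (T (suc a))) k
F-twos a zero = refl
F-twos a (suc zero) = refl
F-twos a (suc (suc k)) = refl

D-step : ∀ m k → D (suc m) k ≡ D m k + shift (D m) k + shift (U m) k
D-step m k = begin
    sumTo m (λ i → F (i ∸ 1) (suc (suc m ∸ i)) k) + F m (suc (m ∸ m)) k
      ≡⟨ cong₂ _+_ (sumTo-cong m (λ i _ i≤m → trans (cong (λ v → F (i ∸ 1) (suc v) k) (+-∸-assoc 1 i≤m)) (F-ones-step (i ∸ 1) (m ∸ i) k)))
                   (trans (cong (λ v → F m (suc v) k) (n∸n≡0 m)) (F-one m k)) ⟩
    sumTo m (λ i → F (i ∸ 1) (suc (m ∸ i)) k + shift (F (i ∸ 1) (suc (m ∸ i))) k) + shift (U m) k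
      ≡⟨ cong (_+ shift (U m) k) (trans (sumTo-+ m _ _) (cong (D m k +_) (sumTo-shift m (λ i → F (i ∸ 1) (suc (m ∸ i))) k))) ⟩
    D m k + shift (D m) k + shift (U m) k ∎
  where open ≡-Reasoning

U-zero : ∀ k → U 0 k ≡ unit k
U-zero zero = refl
U-zero (suc k) = refl

U-suc : ∀ m k → U (suc m) k ≡ D (suc m) k + shift (shift (T (suc m))) k
U-suc m k = trans (U-split (suc m) k) (cong (D (suc m) k +_) (F-twos m k))

U-recurrence : ∀ m k → U (suc (suc m)) k + shift³ (T (suc m)) k ≡ byOnePlusQ² (U (suc m)) k
U-recurrence m k = begin
    U (suc m′) k + q³T
      ≡⟨ cong (_+ q³T) (trans (U-suc m′ k) (cong₂ _+_ (D-step m′ k) (trans (shift-cong (shift-+ (T m′) (U m′)) k) (shift-+ (shift (T m′)) (shift (U m′)) k)))) ⟩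
    (d + qd + qU) + (q²T + q²U) + q³T
      ≡⟨ cong (λ z → (d + qd + z) + (q²T + q²U) + q³T) qU≡ ⟩
    (d + qd + (qd + q³T)) + (q²T + q²U) + q³T
      ≡⟨ regroup d qd q³T q²T q²U ⟩
    (d + q²T) + (qd + q³T) + (qd + q³T) + q²U
      ≡⟨ cong₂ _+_ (cong₂ _+_ (cong₂ _+_ (sym (U-suc m k)) (sym qU≡)) (sym qU≡)) refl ⟩
    byOnePlusQ² (U m′) k ∎
  where
  open ≡-Reasoning
  m′ = suc m
  d = D m′ k
  qd = shift (D m′) k
  qU = shift (U m′) k
  q²T = shift (shift (T m′)) k
  q²U = shift (shift (U m′)) k
  q³T = shift³ (T m′) k
  qU≡ : qU ≡ qd + q³T
  qU≡ = trans (shift-cong (U-suc m) k) (shift-+ (D m′) (shift (shift (T m′))) k)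
  regroup : ∀ d qd q³t q²t q²u → (d + qd + (qd + q³t)) + (q²t + q²u) + q³t ≡ (d + q²t) + (qd + q³t) + (qd + q³t) + q²u
  regroup = solve-∀

sumT : ℕ → ℕ → ℕ
sumT j k = sumTo j (λ i → T i k)

T-one : ∀ k → T 1 k ≡ unit k
T-one = U-zero

U-one : ∀ k → U 1 k ≡ shift unit k + shift (shift unit) k
U-one k = trans (U-suc 0 k) (cong₂ _+_ (trans (F-one 0 k) (shift-cong U-zero k)) (shift-cong (shift-cong T-one) k))

T-recurrence : ∀ m k → T (3 + m) k + shift³ (sumT (1 + m)) k + shift unit k ≡ byOnePlusQ² (T (2 + m)) k
T-recurrence zero k = begin
    (T 2 k + U 2 k) + shift³ (T 1) k + q
      ≡⟨ regroup (T 2 k) (U 2 k) (shift³ (T 1) k) q ⟩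
    T 2 k + (U 2 k + shift³ (T 1) k) + q
      ≡⟨ cong (λ z → T 2 k + z + q) (U-recurrence 0 k) ⟩
    (T 1 k + U 1 k) + byOnePlusQ² (U 1) k + q
      ≡⟨ cong₂ (λ z w → (z + w) + byOnePlusQ² (U 1) k + q) (T-one k) (U-one k) ⟩
    (unit k + (q + shift (shift unit) k)) + byOnePlusQ² (U 1) k + q
      ≡⟨ regroup′ (unit k) q (shift (shift unit) k) (byOnePlusQ² (U 1) k) ⟩
    byOnePlusQ² unit k + byOnePlusQ² (U 1) k
      ≡⟨ cong (_+ byOnePlusQ² (U 1) k) (sym (byOnePlusQ²-cong T-one k)) ⟩
    byOnePlusQ² (T 1) k + byOnePlusQ² (U 1) k
      ≡⟨ sym (byOnePlusQ²-+ (T 1) (U 1) k) ⟩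
    byOnePlusQ² (T 2) k ∎
  where
  open ≡-Reasoning
  q = shift unit k
  regroup : ∀ a b c d → (a + b) + c + d ≡ a + (b + c) + d
  regroup = solve-∀
  regroup′ : ∀ d sd s2d x → (d + (sd + s2d)) + x + sd ≡ (d + sd + sd + s2d) + x
  regroup′ = solve-∀
T-recurrence (suc m) k = begin
    (T3 + U3) + shift³ (λ j → sumT (1 + m) j + T (2 + m) j) k + q
      ≡⟨ cong (λ z → (T3 + U3) + z + q) (shift³-+ (sumT (1 + m)) (T (2 + m)) k) ⟩
    (T3 + U3) + (shift³ (sumT (1 + m)) k + shift³ (T (2 + m)) k) + q
      ≡⟨ regroup T3 U3 (shift³ (sumT (1 + m)) k) (shift³ (T (2 + m)) k) q ⟩
    (T3 + shift³ (sumT (1 + m)) k + q) + (U3 + shift³ (T (2 + m)) k)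
      ≡⟨ cong₂ _+_ (T-recurrence m k) (U-recurrence (suc m) k) ⟩
    byOnePlusQ² (T (2 + m)) k + byOnePlusQ² (U (2 + m)) k
      ≡⟨ sym (byOnePlusQ²-+ (T (2 + m)) (U (2 + m)) k) ⟩
    byOnePlusQ² (T (3 + m)) k ∎
  where
  open ≡-Reasoning
  q = shift unit k
  T3 = T (3 + m) k
  U3 = U (3 + m) k
  regroup : ∀ t u a b d → (t + u) + (a + b) + d ≡ (t + a + d) + (u + b)
  regroup = solve-∀

timesQ : Poly → Poly
timesQ X zero = ℤ.+ 0
timesQ X (suc k) = X k

timesQ-cong : ∀ {X Y : Poly} → (∀ j → X j ≡ Y j) → ∀ k → timesQ X k ≡ timesQ Y k
timesQ-cong h zero = refl
timesQ-cong h (suc k) = h k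

timesQ-zero : ∀ {X : Poly} → (∀ j → X j ≡ ℤ.+ 0) → ∀ k → timesQ X k ≡ ℤ.+ 0
timesQ-zero h zero = refl
timesQ-zero h (suc k) = h k

⊗-suc : ∀ f g m → (f ⊗ g) (suc m) ≡ f 0 ℤ.* g (suc m) ℤ.+ ((λ i → f (suc i)) ⊗ g) m
⊗-suc f g m = cong (λ l → f 0 ℤ.* g (suc m) ℤ.+ foldr ℤ._+_ (ℤ.+ 0) l)
  (trans (ListP.map-applyUpTo (λ i → suc i) (λ i → f i ℤ.* g (suc m ∸ i)) (suc m))
         (sym (ListP.map-applyUpTo (λ i → i) (λ i → f (suc i) ℤ.* g (m ∸ i)) (suc m))))

⊗-unfold : ∀ f g m → (f ⊗ g) m ≡ f 0 ℤ.* g m ℤ.+ timesQ ((λ i → f (suc i)) ⊗ g) m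
⊗-unfold f g zero = refl
⊗-unfold f g (suc m) = ⊗-suc f g m

⊗-congˡ : ∀ {f f'} g → (∀ i → f i ≡ f' i) → ∀ m → (f ⊗ g) m ≡ (f' ⊗ g) m
⊗-congˡ {f} {f'} g h zero = cong (λ z → z ℤ.* g 0 ℤ.+ ℤ.+ 0) (h 0)
⊗-congˡ {f} {f'} g h (suc m) = trans (⊗-suc f g m)
  (trans (cong₂ (λ a b → a ℤ.* g (suc m) ℤ.+ b) (h 0) (⊗-congˡ g (λ i → h (suc i)) m)) (sym (⊗-suc f' g m)))

⊗-zeroˡ : ∀ {f} g → (∀ i → f i ≡ ℤ.+ 0) → ∀ m → (f ⊗ g) m ≡ ℤ.+ 0
⊗-zeroˡ {f} g h zero = cong (λ z → z ℤ.* g 0 ℤ.+ ℤ.+ 0) (h 0)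
⊗-zeroˡ {f} g h (suc m) = trans (⊗-suc f g m) (cong₂ (λ a b → a ℤ.* g (suc m) ℤ.+ b) (h 0) (⊗-zeroˡ g (λ i → h (suc i)) m))

qpow0-⊗ : ∀ g N → (qpow 0 ⊗ g) N ≡ g N
qpow0-⊗ g N = trans (⊗-unfold (qpow 0) g N)
  (trans (cong (λ z → ℤ.+ 1 ℤ.* g N ℤ.+ z) (timesQ-zero (⊗-zeroˡ g (λ i → refl)) N)) (trans (ℤP.+-identityʳ _) (ℤP.*-identityˡ (g N))))

qpow-suc-⊗ : ∀ d g N → (qpow (suc d) ⊗ g) N ≡ timesQ (qpow d ⊗ g) N
qpow-suc-⊗ d g N = trans (⊗-unfold (qpow (suc d)) g N) (ℤP.+-identityˡ _)

qpow3-⊗ : ∀ g N → (qpow 3 ⊗ g) N ≡ timesQ (timesQ (timesQ g)) N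
qpow3-⊗ g N = trans (qpow-suc-⊗ 2 g N) (timesQ-cong (λ M → trans (qpow-suc-⊗ 1 g M)
                (timesQ-cong (λ M' → trans (qpow-suc-⊗ 0 g M') (timesQ-cong (qpow0-⊗ g) M')) M)) N)

onePlusQ²-coeff : ∀ m → (onePlusQ ⊗ onePlusQ) m ≡ onePlusQ m ℤ.+ timesQ onePlusQ m
onePlusQ²-coeff m = trans (⊗-unfold onePlusQ onePlusQ m)
  (cong₂ ℤ._+_ (ℤP.*-identityˡ (onePlusQ m))
               (timesQ-cong (λ M → trans (⊗-congˡ {λ i → onePlusQ (suc i)} {qpow 0} onePlusQ (λ i → ℤP.+-identityˡ (qpow 0 i)) M) (qpow0-⊗ onePlusQ M)) m))

onePlusQ²-⊗ : ∀ g N → ((onePlusQ ⊗ onePlusQ) ⊗ g) N ≡ g N ℤ.+ timesQ g N ℤ.+ timesQ g N ℤ.+ timesQ (timesQ g) N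
onePlusQ²-⊗ g N = begin
    (c ⊗ g) N
      ≡⟨ ⊗-unfold c g N ⟩
    c 0 ℤ.* g N ℤ.+ timesQ (c₁ ⊗ g) N
      ≡⟨ cong₂ ℤ._+_ (ℤP.*-identityˡ (g N)) (timesQ-cong (λ M → trans (⊗-unfold c₁ g M) (cong (λ z → c 1 ℤ.* g M ℤ.+ z) (timesQ-cong c₂-⊗ M))) N) ⟩
    g N ℤ.+ timesQ (λ M → ℤ.+ 2 ℤ.* g M ℤ.+ timesQ g M) N
      ≡⟨ cong (λ z → g N ℤ.+ z) (timesQ-cong (λ M → cong (ℤ._+ timesQ g M) (double (g M))) N) ⟩
    g N ℤ.+ timesQ (λ M → g M ℤ.+ g M ℤ.+ timesQ g M) N
      ≡⟨ cong (λ z → g N ℤ.+ z) (distribute N) ⟩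
    g N ℤ.+ (timesQ g N ℤ.+ timesQ g N ℤ.+ timesQ (timesQ g) N)
      ≡⟨ reassociate (g N) (timesQ g N) (timesQ g N) (timesQ (timesQ g) N) ⟩
    g N ℤ.+ timesQ g N ℤ.+ timesQ g N ℤ.+ timesQ (timesQ g) N ∎
  where
  open ≡-Reasoning
  c c₁ c₂ : Poly
  c = onePlusQ ⊗ onePlusQ
  c₁ i = c (suc i)
  c₂ i = c (suc (suc i))
  -- the coefficient c₂ ⊗ g is g, since c has degree 2
  c₂-⊗ : ∀ M → (c₂ ⊗ g) M ≡ g M
  c₂-⊗ M = trans (⊗-unfold c₂ g M)
    (trans (cong₂ ℤ._+_ (ℤP.*-identityˡ (g M)) (timesQ-zero (⊗-zeroˡ g (λ i → onePlusQ²-coeff (suc (suc (suc i))))) M)) (ℤP.+-identityʳ (g M)))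
  double : ∀ x → ℤ.+ 2 ℤ.* x ≡ x ℤ.+ x
  double x = trans (ℤP.*-distribʳ-+ x (ℤ.+ 1) (ℤ.+ 1)) (cong₂ ℤ._+_ (ℤP.*-identityˡ x) (ℤP.*-identityˡ x))
  distribute : ∀ N → timesQ (λ M → g M ℤ.+ g M ℤ.+ timesQ g M) N ≡ timesQ g N ℤ.+ timesQ g N ℤ.+ timesQ (timesQ g) N
  distribute zero = refl
  distribute (suc N) = refl
  reassociate : ∀ a b c d → a ℤ.+ (b ℤ.+ c ℤ.+ d) ≡ a ℤ.+ b ℤ.+ c ℤ.+ d
  reassociate = ℤSolver.solve-∀

P : ℕ → ℕ → ℕ
P r zero = 0
P r (suc k) = numPartitions r (suc k)

𝒫C≡P : ∀ r N → 𝒫C r N ≡ ℤ.+ P r N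
𝒫C≡P r zero = refl
𝒫C≡P r (suc N) = refl

sumP : ℕ → ℕ → ℕ
sumP j N = sumTo j (λ i → P i N)

sum𝒫C≡sumP : ∀ m N → sum𝒫C m N ≡ ℤ.+ sumP m N
sum𝒫C≡sumP zero N = refl
sum𝒫C≡sumP (suc m) N = trans (cong₂ ℤ._+_ (sum𝒫C≡sumP m N) (𝒫C≡P (suc m) N)) (sym (ℤP.pos-+ (sumP m N) (P (suc m) N)))

P≡shiftT : ∀ n k → P (suc n) k ≡ shift (T (suc n)) k
P≡shiftT n zero = refl
P≡shiftT n (suc k) = numPartitions≡T n k

sumP≡shift : ∀ j k → sumP j k ≡ shift (sumT j) k
sumP≡shift j k = trans (sumTo-cong j (λ { (suc i) _ _ → P≡shiftT i k })) (sumTo-shift j T k)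

P-recurrence : ∀ m N → P (3 + m) N + shift³ (sumP (1 + m)) N + shift (shift unit) N ≡ byOnePlusQ² (P (2 + m)) N
P-recurrence m N =
  trans (cong₂ (λ a b → a + b + shift (shift unit) N) (P≡shiftT (2 + m) N) (shift-cong (shift-cong (shift-cong (sumP≡shift (1 + m)))) N))
        (trans (shifted N) (sym (byOnePlusQ²-cong (P≡shiftT (1 + m)) N)))
  where
  shifted : ∀ N → shift (T (3 + m)) N + shift³ (shift (sumT (1 + m))) N + shift (shift unit) N ≡ byOnePlusQ² (shift (T (2 + m))) N
  shifted zero = refl
  shifted (suc k) = T-recurrence m k

q²-coeff : ∀ N → ℤ.+ shift (shift unit) N ≡ qpow 2 N
q²-coeff zero = refl
q²-coeff (suc zero) = refl
q²-coeff (suc (suc zero)) = refl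
q²-coeff (suc (suc (suc N))) = refl

timesQ-lift : ∀ X N → timesQ (λ n → ℤ.+ X n) N ≡ ℤ.+ shift X N
timesQ-lift X zero = refl
timesQ-lift X (suc N) = refl

timesQ-lift-⊖ : ∀ X d N → timesQ (λ n → ℤ.+ X n ℤ.- qpow d n) N ≡ ℤ.+ shift X N ℤ.- qpow (suc d) N
timesQ-lift-⊖ X d zero = refl
timesQ-lift-⊖ X d (suc N) = refl

lifted-recurrence : ∀ m N →
  ℤ.+ P (3 + m) N ℤ.+ ℤ.+ shift³ (sumP (1 + m)) N ℤ.+ qpow 2 N
  ≡ ℤ.+ P (2 + m) N ℤ.+ ℤ.+ shift (P (2 + m)) N ℤ.+ ℤ.+ shift (P (2 + m)) N ℤ.+ ℤ.+ shift (shift (P (2 + m))) N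
lifted-recurrence m N = begin
    ℤ.+ a ℤ.+ ℤ.+ s ℤ.+ qpow 2 N                       ≡⟨ cong (λ z → ℤ.+ a ℤ.+ ℤ.+ s ℤ.+ z) (sym (q²-coeff N)) ⟩
    ℤ.+ a ℤ.+ ℤ.+ s ℤ.+ ℤ.+ d                          ≡⟨ sym (trans (ℤP.pos-+ (a + s) d) (cong (λ z → z ℤ.+ ℤ.+ d) (ℤP.pos-+ a s))) ⟩
    ℤ.+ (a + s + d)                                    ≡⟨ cong ℤ.+_ (P-recurrence m N) ⟩
    ℤ.+ (b₀ + b₁ + b₁ + b₂)                            ≡⟨ trans (ℤP.pos-+ (b₀ + b₁ + b₁) b₂) (cong (λ z → z ℤ.+ ℤ.+ b₂)
                                                            (trans (ℤP.pos-+ (b₀ + b₁) b₁) (cong (λ z → z ℤ.+ ℤ.+ b₁) (ℤP.pos-+ b₀ b₁)))) ⟩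
    ℤ.+ b₀ ℤ.+ ℤ.+ b₁ ℤ.+ ℤ.+ b₁ ℤ.+ ℤ.+ b₂            ∎
  where
  open ≡-Reasoning
  a = P (3 + m) N
  s = shift³ (sumP (1 + m)) N
  d = shift (shift unit) N
  b₀ = P (2 + m) N
  b₁ = shift (P (2 + m)) N
  b₂ = shift (shift (P (2 + m))) N

expand-rhs : ∀ m N →
  (((onePlusQ ⊗ onePlusQ) ⊗ (𝒫C (2 + m) ⊖ qpow 1)) ⊖ (qpow 3 ⊗ sum𝒫C (1 + m)) ⊕ (qpow 1 ⊕ qpow 2 ⊕ qpow 3)) N
  ≡ ((ℤ.+ P (2 + m) N ℤ.- qpow 1 N) ℤ.+ (ℤ.+ shift (P (2 + m)) N ℤ.- qpow 2 N) ℤ.+ (ℤ.+ shift (P (2 + m)) N ℤ.- qpow 2 N)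
       ℤ.+ (ℤ.+ shift (shift (P (2 + m))) N ℤ.- qpow 3 N))
    ℤ.- ℤ.+ shift³ (sumP (1 + m)) N ℤ.+ (qpow 1 N ℤ.+ qpow 2 N ℤ.+ qpow 3 N)
expand-rhs m N = cong₂ (λ x y → x ℤ.- y ℤ.+ (qpow 1 N ℤ.+ qpow 2 N ℤ.+ qpow 3 N)) square cube
  where
  g : Poly
  g = 𝒫C (2 + m) ⊖ qpow 1
  g≡ : ∀ M → g M ≡ ℤ.+ P (2 + m) M ℤ.- qpow 1 M
  g≡ M = cong (ℤ._- qpow 1 M) (𝒫C≡P (2 + m) M)
  qg≡ : ∀ M → timesQ g M ≡ ℤ.+ shift (P (2 + m)) M ℤ.- qpow 2 M
  qg≡ M = trans (timesQ-cong g≡ M) (timesQ-lift-⊖ (P (2 + m)) 1 M)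
  square = trans (onePlusQ²-⊗ g N)
    (cong₂ ℤ._+_ (cong₂ ℤ._+_ (cong₂ ℤ._+_ (g≡ N) (qg≡ N)) (qg≡ N)) (trans (timesQ-cong qg≡ N) (timesQ-lift-⊖ (shift (P (2 + m))) 2 N)))
  cube = trans (qpow3-⊗ (sum𝒫C (1 + m)) N)
    (trans (timesQ-cong (timesQ-cong (λ M → trans (timesQ-cong (sum𝒫C≡sumP (1 + m)) M) (timesQ-lift (sumP (1 + m)) M))) N)
    (trans (timesQ-cong (timesQ-lift (shift (sumP (1 + m)))) N) (timesQ-lift (shift (shift (sumP (1 + m)))) N)))

-- The final ring computation: from  p + s + q₂ = b₀ + 2 b₁ + b₂  follow the
-- subtractions of (1 + q)² q = q + 2q² + q³ and the addition of q + q² + q³.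
rearrange : ∀ (p s b₀ b₁ b₂ q₁ q₂ q₃ : ℤ) → p ℤ.+ s ℤ.+ q₂ ≡ b₀ ℤ.+ b₁ ℤ.+ b₁ ℤ.+ b₂ →
  p ≡ ((b₀ ℤ.- q₁) ℤ.+ (b₁ ℤ.- q₂) ℤ.+ (b₁ ℤ.- q₂) ℤ.+ (b₂ ℤ.- q₃)) ℤ.- s ℤ.+ (q₁ ℤ.+ q₂ ℤ.+ q₃)
rearrange p s b₀ b₁ b₂ q₁ q₂ q₃ e = begin
    p                                                    ≡⟨ isolate p s q₂ ⟩
    (p ℤ.+ s ℤ.+ q₂) ℤ.- s ℤ.- q₂                        ≡⟨ cong (λ z → z ℤ.- s ℤ.- q₂) e ⟩
    (b₀ ℤ.+ b₁ ℤ.+ b₁ ℤ.+ b₂) ℤ.- s ℤ.- q₂               ≡⟨ redistribute b₀ b₁ b₂ s q₁ q₂ q₃ ⟩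
    ((b₀ ℤ.- q₁) ℤ.+ (b₁ ℤ.- q₂) ℤ.+ (b₁ ℤ.- q₂) ℤ.+ (b₂ ℤ.- q₃)) ℤ.- s ℤ.+ (q₁ ℤ.+ q₂ ℤ.+ q₃) ∎
  where
  open ≡-Reasoning
  isolate : ∀ p s q → p ≡ (p ℤ.+ s ℤ.+ q) ℤ.- s ℤ.- q
  isolate = ℤSolver.solve-∀
  redistribute : ∀ b₀ b₁ b₂ s q₁ q₂ q₃ →
    (b₀ ℤ.+ b₁ ℤ.+ b₁ ℤ.+ b₂) ℤ.- s ℤ.- q₂ ≡ ((b₀ ℤ.- q₁) ℤ.+ (b₁ ℤ.- q₂) ℤ.+ (b₁ ℤ.- q₂) ℤ.+ (b₂ ℤ.- q₃)) ℤ.- s ℤ.+ (q₁ ℤ.+ q₂ ℤ.+ q₃)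
  redistribute = ℤSolver.solve-∀

theorem4p2 : (r : ℕ) → 3 ≤ r → (n : ℕ) →
  𝒫C r n ≡ (((onePlusQ ⊗ onePlusQ) ⊗ (𝒫C (r ∸ 1) ⊖ qpow 1))
             ⊖ (qpow 3 ⊗ sum𝒫C (r ∸ 2))
             ⊕ (qpow 1 ⊕ qpow 2 ⊕ qpow 3)) n
theorem4p2 (suc (suc (suc m))) (s≤s (s≤s (s≤s z≤n))) N = begin
    𝒫C (3 + m) N
      ≡⟨ 𝒫C≡P (3 + m) N ⟩
    ℤ.+ P (3 + m) N
      ≡⟨ rearrange (ℤ.+ P (3 + m) N) (ℤ.+ shift³ (sumP (1 + m)) N) (ℤ.+ p₂ N) (ℤ.+ shift p₂ N) (ℤ.+ shift (shift p₂) N)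
                   (qpow 1 N) (qpow 2 N) (qpow 3 N) (lifted-recurrence m N) ⟩
    _
      ≡⟨ sym (expand-rhs m N) ⟩
    (((onePlusQ ⊗ onePlusQ) ⊗ (𝒫C (2 + m) ⊖ qpow 1)) ⊖ (qpow 3 ⊗ sum𝒫C (1 + m)) ⊕ (qpow 1 ⊕ qpow 2 ⊕ qpow 3)) N ∎
  where
  open ≡-Reasoning
  p₂ = P (2 + m)
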